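{- Let $n \geq 3$. Then (1) $cp_n(\emptyset) = 2^{n-1}$; (2) $cp_n(\{i\}) = 2^{n-2}(2^{i-2}-1)$ for every $i \in [3,n]$; (3) $cp_n(\{i,j\}) = 2^{n-3}(2^{i-2}-1)(2^{j-i-1}-1) + 2^{n+j-i-5}\cdot 3\,(3^{i-2}-2^{i-1}+1)$ for all $i,j\in[3,n]$ with $i<j$.
   Context: For integers $a \le b$, $[a,b]=\{a,a+1,\dots,b\}$, $[a,b]=\emptyset$ if $a>b$, and $[n]=[1,n]$. $\mathfrak{S}_n$ is the set of permutations of $[n]$, written in one-line form $\sigma=(\sigma(1)\cdots\sigma(n))$. The circular peak set of $\sigma\in\mathfrak{S}_n$ is $CP(\sigma)=\{\sigma(i) : 2\le i\le n-1,\ \sigma(i-1)<\sigma(i)>\sigma(i+1)\}$. For $S\subseteq[n]$, $CP_n(S)=\{\sigma\in\mathfrak{S}_n : CP(\sigma)=S\}$ and $cp_n(S)=|CP_n(S)|$. -}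

module Defs where

open import Data.Nat using (ℕ; zero; suc; _<_; _>_; _<?_)
open import Data.List using (List; []; _∷_; map; upTo; length)
open import Data.List.Membership.Propositional using (_∈_)
open import Data.List.Relation.Unary.Unique.Propositional using (Unique)
open import Data.List.Relation.Unary.All using (All)
open import Data.List.Relation.Binary.Permutation.Propositional using (_↭_)
open import Data.Product using (_×_; ∃-syntax)
open import Data.Bool using (if_then_else_; _∧_)
open import Relation.Nullary.Decidable using (does)
open import Function.Bundles using (_⇔_)
open import Relation.Binary.PropositionalEquality using (_≡_)

[_] : ℕ → List ℕ
[ n ] = map suc (upTo n)

IsPerm : ℕ → List ℕ → Set
IsPerm n σ = σ ↭ [ n ]

peaks : List ℕ → List ℕ
peaks (a ∷ b ∷ c ∷ rest) =
  if does (a <? b) ∧ does (c <? b)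
  then b ∷ peaks (b ∷ c ∷ rest)
  else peaks (b ∷ c ∷ rest)
peaks _ = []

CP-is : List ℕ → List ℕ → Set
CP-is σ S = ∀ x → (x ∈ peaks σ) ⇔ (x ∈ S)

InCP : ℕ → List ℕ → List ℕ → Set
InCP n S σ = IsPerm n σ × CP-is σ S

cp : ℕ → List ℕ → ℕ → Set
cp n S k = ∃[ L ] (Unique L × All (InCP n S) L × (∀ σ → InCP n S σ → σ ∈ L) × length L ≡ k)

module Submission where

-- Inserting the maximum n into a permutation τ of [n - 1] at either end leaves the peak set
-- unchanged, while each of the n - 2 inner slots adds the peak n and destroys the peak of τ
-- next to the slot, if any; every peak of τ lies next to exactly two slots. Tallying the peaks
-- of σ as (#peaks in S, #peaks outside S) and counting permutations by tally therefore gives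
-- linear recurrences in n, with the roles of the two coordinates exchanged when n ∈ S. A
-- duplicate-free list of |S| elements of a duplicate-free S enumerates S, so CP(σ) = S exactly
-- when the tally is (|S|, 0). For |S| ≤ 2 only tallies with at most two peaks enter, and the
-- recurrences are solved in closed form by induction over ℤ.

open import Defs

module PeakTallies where
  open import Data.Bool using (Bool; true; false; not; _∧_)
  open import Data.Bool.Properties using (∧-zeroʳ; ∧-comm; T-∧; T-≡)
  open import Data.Empty using (⊥-elim)
  open import Data.List using (List; []; _∷_; _++_; map; concatMap; length; upTo; filter)
  open import Data.List.Membership.Propositional using (_∈_; _∉_; find; lose)
  open import Data.List.Membership.Propositional.Properties
    using (∈-map⁺; ∈-map⁻; ∈-∃++; ∈-concatMap⁺; ∈-concatMap⁻; ∈-filter⁺; ∈-filter⁻)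
  open import Data.List.Properties
    using (length-map; length-upTo; upTo-∷ʳ; map-++; filter-accept; filter-reject; filter-all; ∷-injectiveˡ; ∷-injectiveʳ)
  open import Data.List.Relation.Binary.Permutation.Propositional
    using (_↭_; ↭-prep; ↭-swap; ↭-refl; ↭-sym; ↭-trans; ↭-reflexive; ↭⇒↭ₛ)
  open import Data.List.Relation.Binary.Permutation.Propositional.Properties
    using (↭-empty-inv; All-resp-↭; ∈-resp-↭; shift; drop-∷; ∷↭∷ʳ; ↭-length)
  import Data.List.Relation.Binary.Permutation.Setoid.Properties as PermutationSetoid
  open import Data.List.Relation.Binary.Sublist.Propositional using (_⊆_; []; _∷_; _∷ʳ_)
  open import Data.List.Relation.Binary.Sublist.Propositional.Properties using (All-resp-⊆)
  open import Data.List.Relation.Unary.All as All using (All; []; _∷_)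
  open import Data.List.Relation.Unary.All.Properties using (all-upTo; map⁺)
  open import Data.List.Relation.Unary.Any using (here; there)
  open import Data.List.Relation.Unary.Unique.Propositional using (Unique; []; _∷_)
  import Data.List.Relation.Unary.Unique.Propositional.Properties as Unique
  open import Data.Nat using (ℕ; zero; suc; _+_; _*_; _^_; _∸_; _<_; _≤_; _≟_; _<?_; z≤n; s≤s; s≤s⁻¹)
  open import Data.Nat.Properties
    using ( <-irrefl; <-asym; <-trans; <ᵇ⇒<; ≤-refl; ≤-reflexive; ≤-trans; ≤-antisym; m≤n⇒m≤1+n; m≤m+n
          ; m^n>0; *-monoʳ-≤; m∸n+n≡m; m+n∸n≡m; m+n∸m≡n; suc-injective; +-comm; +-assoc; +-suc; +-identityʳ; *-zeroʳ; *-distribˡ-+)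
  open import Data.Nat.Tactic.RingSolver using (solve-∀)
  open import Data.List.Membership.DecPropositional _≟_ using (_∈?_)
  open import Data.Product using (_×_; _,_; proj₁; proj₂; swap; ∃-syntax)
  open import Function using (_∘_; case_of_)
  open import Function.Bundles using (Equivalence; _⇔_; mk⇔)
  open import Relation.Binary.PropositionalEquality
    using (_≡_; _≢_; refl; sym; trans; cong; cong₂; setoid; subst; subst₂; module ≡-Reasoning)
  open import Relation.Nullary using (Dec; ¬_; ¬?; yes; no; does; _×-dec_)
  open import Relation.Nullary.Decidable using (dec-true; dec-false; map′)
  open ≡-Reasoning

  cong₃ : ∀ {A B C D : Set} (f : A → B → C → D) {a b c a′ b′ c′} →
          a ≡ a′ → b ≡ b′ → c ≡ c′ → f a b c ≡ f a′ b′ c′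
  cong₃ f refl refl refl = refl

  -- Permutations of [n]

  insertions : ℕ → List ℕ → List (List ℕ)
  insertions n []      = (n ∷ []) ∷ []
  insertions n (x ∷ τ) = (n ∷ x ∷ τ) ∷ map (x ∷_) (insertions n τ)

  permutations : ℕ → List (List ℕ)
  permutations zero    = [] ∷ []
  permutations (suc m) = concatMap (insertions (suc m)) (permutations m)

  insertions-↭ : ∀ {n σ} τ → σ ∈ insertions n τ → σ ↭ n ∷ τ
  insertions-↭ []      (here refl) = ↭-refl
  insertions-↭ (x ∷ τ) (here refl) = ↭-refl
  insertions-↭ {n} (x ∷ τ) (there p) with ∈-map⁻ (x ∷_) p
  ... | σ , σ∈ , refl = ↭-trans (↭-prep x (insertions-↭ τ σ∈)) (↭-swap x n ↭-refl)

  ∈-insertions : ∀ n α β → α ++ n ∷ β ∈ insertions n (α ++ β)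
  ∈-insertions n []      []      = here refl
  ∈-insertions n []      (x ∷ β) = here refl
  ∈-insertions n (a ∷ α) β       = there (∈-map⁺ (a ∷_) (∈-insertions n α β))

  [suc]↭ : ∀ m → [ suc m ] ↭ suc m ∷ [ m ]
  [suc]↭ m = ↭-trans (↭-reflexive [suc]≡) (↭-sym (∷↭∷ʳ (suc m) [ m ]))
    where
    [suc]≡ : [ suc m ] ≡ [ m ] ++ suc m ∷ []
    [suc]≡ = trans (cong (map suc) (sym (upTo-∷ʳ m))) (map-++ suc (upTo m) (m ∷ []))

  ∈-permutations⁻ : ∀ m {σ} → σ ∈ permutations m → σ ↭ [ m ]
  ∈-permutations⁻ zero    (here refl) = ↭-refl
  ∈-permutations⁻ (suc m) p with find (∈-concatMap⁻ (insertions (suc m)) p)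
  ... | τ , τ∈ , σ∈ =
    ↭-trans (insertions-↭ τ σ∈) (↭-trans (↭-prep (suc m) (∈-permutations⁻ m τ∈)) (↭-sym ([suc]↭ m)))

  ∈-permutations⁺ : ∀ m {σ} → σ ↭ [ m ] → σ ∈ permutations m
  ∈-permutations⁺ zero p rewrite ↭-empty-inv p = here refl
  ∈-permutations⁺ (suc m) p with ∈-∃++ (∈-resp-↭ (↭-sym (↭-trans p ([suc]↭ m))) (here refl))
  ... | α , β , refl = ∈-concatMap⁺ (insertions (suc m)) (lose (∈-permutations⁺ m rest↭) (∈-insertions (suc m) α β))
    where
    rest↭ : α ++ β ↭ [ m ]
    rest↭ = drop-∷ (↭-trans (↭-sym (shift (suc m) α β)) (↭-trans p ([suc]↭ m)))

  []-bounded : ∀ m → All (_< suc m) [ m ]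
  []-bounded m = map⁺ (All.map s≤s (all-upTo m))

  []-unique : ∀ m → Unique [ m ]
  []-unique m = Unique.map⁺ suc-injective (Unique.upTo⁺ m)

  Unique-resp-↭ : ∀ {xs ys : List ℕ} → xs ↭ ys → Unique xs → Unique ys
  Unique-resp-↭ p = PermutationSetoid.Unique-resp-↭ (setoid ℕ) (↭⇒↭ₛ p)

  permutations-bounded : ∀ m {τ} → τ ∈ permutations m → All (_< suc m) τ
  permutations-bounded m τ∈ = All-resp-↭ (↭-sym (∈-permutations⁻ m τ∈)) ([]-bounded m)

  permutations-unique-entries : ∀ m {τ} → τ ∈ permutations m → Unique τ
  permutations-unique-entries m τ∈ = Unique-resp-↭ (↭-sym (∈-permutations⁻ m τ∈)) ([]-unique m)

  Unique-concatMap : ∀ {A B : Set} (f : A → List B) (key : B → A) {xs : List A} →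
    Unique xs → All (λ x → Unique (f x)) xs → All (λ x → All (λ y → key y ≡ x) (f x)) xs →
    Unique (concatMap f xs)
  Unique-concatMap f key {[]}     _          _         _         = []
  Unique-concatMap f key {x ∷ xs} (x≢ ∷ uxs) (ux ∷ us) (kx ∷ ks) =
    Unique.++⁺ ux (Unique-concatMap f key uxs us ks) disjoint
    where
    disjoint : ∀ {y} → ¬ (y ∈ f x × y ∈ concatMap f xs)
    disjoint (y∈fx , y∈rest) with find (∈-concatMap⁻ f y∈rest)
    ... | x′ , x′∈ , y∈fx′ =
      All.lookup x≢ x′∈ (trans (sym (All.lookup kx y∈fx)) (All.lookup (All.lookup ks x′∈) y∈fx′))

  _≢?_ : ∀ x n → Dec (x ≢ n)
  x ≢? n = ¬? (x ≟ n)

  remove : ℕ → List ℕ → List ℕ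
  remove n = filter (_≢? n)

  remove-insertions : ∀ n τ {σ} → σ ∈ insertions n τ → remove n σ ≡ remove n τ
  remove-insertions n []      (here refl) = filter-reject (_≢? n) (λ n≢n → n≢n refl)
  remove-insertions n (x ∷ τ) (here refl) = filter-reject (_≢? n) (λ n≢n → n≢n refl)
  remove-insertions n (x ∷ τ) (there p) with ∈-map⁻ (x ∷_) p
  ... | σ , σ∈ , refl with x ≟ n
  ...   | yes x≡n = trans (filter-reject (_≢? n) (λ x≢n → x≢n x≡n))
                      (trans (remove-insertions n τ σ∈) (sym (filter-reject (_≢? n) (λ x≢n → x≢n x≡n))))
  ...   | no  x≢n = trans (filter-accept (_≢? n) x≢n)
                      (trans (cong (x ∷_) (remove-insertions n τ σ∈)) (sym (filter-accept (_≢? n) x≢n)))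

  insertions-unique : ∀ {n} τ → n ∉ τ → Unique (insertions n τ)
  insertions-unique []      _   = [] ∷ []
  insertions-unique {n} (x ∷ τ) n∉ =
    All.tabulate head-fresh ∷ Unique.map⁺ ∷-injectiveʳ (insertions-unique τ (λ n∈ → n∉ (there n∈)))
    where
    head-fresh : ∀ {σ} → σ ∈ map (x ∷_) (insertions n τ) → n ∷ x ∷ τ ≢ σ
    head-fresh σ∈ eq with ∈-map⁻ (x ∷_) σ∈
    ... | _ , _ , refl = n∉ (here (∷-injectiveˡ eq))

  permutations-unique : ∀ m → Unique (permutations m)
  permutations-unique zero    = [] ∷ []
  permutations-unique (suc m) =
    Unique-concatMap (insertions n) (remove n) (permutations-unique m)
      (All.tabulate λ τ∈ → insertions-unique _ λ n∈ → All.lookup (entries-≢ τ∈) n∈ refl)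
      (All.tabulate λ {τ} τ∈ → All.tabulate λ σ∈ →
        trans (remove-insertions n τ σ∈) (filter-all (_≢? n) (entries-≢ τ∈)))
    where
    n : ℕ
    n = suc m
    entries-≢ : ∀ {τ} → τ ∈ permutations m → All (_≢ n) τ
    entries-≢ τ∈ = All.map (λ x<n x≡n → <-irrefl x≡n x<n) (permutations-bounded m τ∈)

  ∑ : {A : Set} → List A → (A → ℕ) → ℕ
  ∑ []       f = 0
  ∑ (x ∷ xs) f = f x + ∑ xs f

  syntax ∑ xs (λ x → e) = ∑[ x ∈ xs ] e

  ∑-++ : {A : Set} (xs ys : List A) (f : A → ℕ) → ∑ (xs ++ ys) f ≡ ∑ xs f + ∑ ys f
  ∑-++ []       ys f = refl
  ∑-++ (x ∷ xs) ys f = trans (cong (f x +_) (∑-++ xs ys f)) (sym (+-assoc (f x) _ _))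

  ∑-map : {A B : Set} (g : A → B) (xs : List A) (f : B → ℕ) → ∑ (map g xs) f ≡ ∑ xs (λ x → f (g x))
  ∑-map g []       f = refl
  ∑-map g (x ∷ xs) f = cong (f (g x) +_) (∑-map g xs f)

  ∑-concatMap : {A B : Set} (g : A → List B) (xs : List A) (f : B → ℕ) →
    ∑ (concatMap g xs) f ≡ ∑[ x ∈ xs ] ∑ (g x) f
  ∑-concatMap g []       f = refl
  ∑-concatMap g (x ∷ xs) f = trans (∑-++ (g x) (concatMap g xs) f) (cong (∑ (g x) f +_) (∑-concatMap g xs f))

  ∑-cong : {A : Set} {f g : A → ℕ} (xs : List A) → (∀ {x} → x ∈ xs → f x ≡ g x) → ∑ xs f ≡ ∑ xs g
  ∑-cong []       _   = refl
  ∑-cong (x ∷ xs) f≗g = cong₂ _+_ (f≗g (here refl)) (∑-cong xs (λ x∈ → f≗g (there x∈)))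

  ∑-+ : {A : Set} (xs : List A) (f g : A → ℕ) → ∑[ x ∈ xs ] (f x + g x) ≡ ∑ xs f + ∑ xs g
  ∑-+ []       f g = refl
  ∑-+ (x ∷ xs) f g = trans (cong (f x + g x +_) (∑-+ xs f g)) (+-+-swap (f x) (g x) _ _)
    where
    +-+-swap : ∀ a b c d → a + b + (c + d) ≡ a + c + (b + d)
    +-+-swap = solve-∀

  ∑-*ˡ : {A : Set} (c : ℕ) (xs : List A) (f : A → ℕ) → ∑[ x ∈ xs ] (c * f x) ≡ c * ∑ xs f
  ∑-*ˡ c []       f = sym (*-zeroʳ c)
  ∑-*ˡ c (x ∷ xs) f = trans (cong (c * f x +_) (∑-*ˡ c xs f)) (sym (*-distribˡ-+ c (f x) _))

  ∑-zero : {A : Set} (xs : List A) → ∑[ x ∈ xs ] 0 ≡ 0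
  ∑-zero []       = refl
  ∑-zero (x ∷ xs) = ∑-zero xs

  -- Peaks and the insertion of a new maximum

  consIf : Bool → ℕ → List ℕ → List ℕ
  consIf true  y P = y ∷ P
  consIf false _ P = P

  isPeak : ℕ → ℕ → ℕ → Bool
  isPeak x y z = does (x <? y) ∧ does (z <? y)

  peaks-∷ : ∀ x y z r → peaks (x ∷ y ∷ z ∷ r) ≡ consIf (isPeak x y z) y (peaks (y ∷ z ∷ r))
  peaks-∷ x y z r with isPeak x y z
  ... | true  = refl
  ... | false = refl

  isPeak-left-max : ∀ {x y} z → x < y → isPeak y x z ≡ false
  isPeak-left-max {x} {y} z x<y rewrite dec-false (y <? x) (<-asym x<y) = refl

  isPeak-right-max : ∀ x {y z} → y < z → isPeak x y z ≡ false
  isPeak-right-max x {y} {z} y<z rewrite dec-false (z <? y) (<-asym y<z) = ∧-zeroʳ (does (x <? y))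

  isPeak-max : ∀ {x y z} → x < y → z < y → isPeak x y z ≡ true
  isPeak-max {x} {y} {z} x<y z<y rewrite dec-true (x <? y) x<y | dec-true (z <? y) z<y = refl

  isPeak⇒> : ∀ x y z → isPeak x y z ≡ true → z < y
  isPeak⇒> x y z eq =
    <ᵇ⇒< z y (proj₂ (Equivalence.to (T-∧ {does (x <? y)}) (Equivalence.from T-≡ eq)))

  peaks-max-∷ : ∀ {n} τ → All (_< n) τ → peaks (n ∷ τ) ≡ peaks τ
  peaks-max-∷ []            _           = refl
  peaks-max-∷ (x ∷ [])      _           = refl
  peaks-max-∷ (x ∷ y ∷ r)   (x<n ∷ _)   rewrite isPeak-left-max y x<n = refl

  peaks-∷-max : ∀ {n} τ → All (_< n) τ → peaks (τ ++ n ∷ []) ≡ peaks τ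
  peaks-∷-max []              _              = refl
  peaks-∷-max (x ∷ [])        _              = refl
  peaks-∷-max (x ∷ y ∷ [])    (_ ∷ y<n ∷ _)  rewrite isPeak-right-max x y<n = refl
  peaks-∷-max (x ∷ y ∷ z ∷ r) (_ ∷ <n)       =
    trans (peaks-∷ x y z (r ++ _)) (trans (cong (consIf _ y) (peaks-∷-max (y ∷ z ∷ r) <n)) (sym (peaks-∷ x y z r)))

  peaks-around-max : ∀ {n} x y r → All (_< n) (x ∷ y ∷ r) → peaks (x ∷ n ∷ y ∷ r) ≡ n ∷ peaks (y ∷ r)
  peaks-around-max x y r (x<n ∷ y<n ∷ <n) rewrite isPeak-max x<n y<n = cong (_ ∷_) (peaks-max-∷ (y ∷ r) (y<n ∷ <n))

  peaks-descent : ∀ y z r → z < y → peaks (y ∷ z ∷ r) ≡ peaks (z ∷ r)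
  peaks-descent y z []      _   = refl
  peaks-descent y z (w ∷ r) z<y rewrite isPeak-left-max w z<y = refl

  removals : {A : Set} → List A → List (List A)
  removals []      = []
  removals (a ∷ P) = P ∷ map (a ∷_) (removals P)

  initInsertions : ℕ → List ℕ → List (List ℕ)
  initInsertions n []      = []
  initInsertions n (x ∷ τ) = (n ∷ x ∷ τ) ∷ map (x ∷_) (initInsertions n τ)

  insertions-init : ∀ n τ → insertions n τ ≡ initInsertions n τ ++ (τ ++ n ∷ []) ∷ []
  insertions-init n []      = refl
  insertions-init n (x ∷ τ) = cong ((n ∷ x ∷ τ) ∷_)
    (trans (cong (map (x ∷_)) (insertions-init n τ)) (map-++ (x ∷_) (initInsertions n τ) _))

  InsertionTransfer : ℕ → (List ℕ → ℕ) → (List ℕ → ℕ) → Set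
  InsertionTransfer n f V = ∀ A B → f (A ++ n ∷ B) ≡ V (A ++ B)

  innerSum : ℕ → (List ℕ → ℕ) → ℕ → List ℕ → ℕ
  innerSum n f x w = ∑[ σ ∈ initInsertions n w ] f (peaks (x ∷ σ))

  innerSum-∷ : ∀ n f x y w →
    innerSum n f x (y ∷ w) ≡ f (peaks (x ∷ n ∷ y ∷ w)) + ∑[ σ ∈ initInsertions n w ] f (peaks (x ∷ y ∷ σ))
  innerSum-∷ n f x y w = cong (f (peaks (x ∷ n ∷ y ∷ w)) +_) (∑-map (y ∷_) (initInsertions n w) _)

  -- Each inner slot creates the peak n and destroys the peak next to it, if any, and each peak
  -- of x ∷ w lies next to exactly two inner slots.
  SweepIdentity : ℕ → (List ℕ → ℕ) → (List ℕ → ℕ) → ℕ → List ℕ → Set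
  SweepIdentity n f V x w =
    innerSum n f x w + 2 * length (peaks (x ∷ w)) * V (peaks (x ∷ w))
      ≡ length w * V (peaks (x ∷ w)) + 2 * ∑ (removals (peaks (x ∷ w))) V

  innerSum-∷∷ : ∀ {n} f V x y z r → All (_< n) (x ∷ y ∷ z ∷ r) → InsertionTransfer n f V →
    innerSum n f x (y ∷ z ∷ r)
      ≡ V (peaks (y ∷ z ∷ r))
        + (f (peaks (y ∷ n ∷ z ∷ r)) + ∑[ ρ ∈ initInsertions n r ] f (consIf (isPeak x y z) y (peaks (y ∷ z ∷ ρ))))
  innerSum-∷∷ {n} f V x y z r (x<n ∷ y<n ∷ z<n ∷ a) tr = begin
    innerSum n f x (y ∷ z ∷ r)
      ≡⟨ innerSum-∷ n f x y (z ∷ r) ⟩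
    f (peaks (x ∷ n ∷ y ∷ z ∷ r)) + (f (peaks (x ∷ y ∷ n ∷ z ∷ r)) + later)
      ≡⟨ cong₃ (λ u v w → u + (v + w)) first-slot second-slot later-slots ⟩
    V (peaks (y ∷ z ∷ r))
      + (f (peaks (y ∷ n ∷ z ∷ r)) + ∑[ ρ ∈ initInsertions n r ] f (consIf (isPeak x y z) y (peaks (y ∷ z ∷ ρ))))
      ∎
    where
    later : ℕ
    later = ∑[ ρ ∈ map (z ∷_) (initInsertions n r) ] f (peaks (x ∷ y ∷ ρ))
    first-slot : f (peaks (x ∷ n ∷ y ∷ z ∷ r)) ≡ V (peaks (y ∷ z ∷ r))
    first-slot = trans (cong f (peaks-around-max x y (z ∷ r) (x<n ∷ y<n ∷ z<n ∷ a))) (tr [] (peaks (y ∷ z ∷ r)))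
    second-slot : f (peaks (x ∷ y ∷ n ∷ z ∷ r)) ≡ f (peaks (y ∷ n ∷ z ∷ r))
    second-slot = cong f (trans (peaks-∷ x y n (z ∷ r)) (cong (λ b → consIf b y _) (isPeak-right-max x y<n)))
    later-slots : later ≡ ∑[ ρ ∈ initInsertions n r ] f (consIf (isPeak x y z) y (peaks (y ∷ z ∷ ρ)))
    later-slots = trans (∑-map (z ∷_) (initInsertions n r) _) (∑-cong (initInsertions n r) (λ {ρ} _ → cong f (peaks-∷ x y z ρ)))

  -- The later inner slots of x ∷ y ∷ z ∷ r keep the status of y, so they are the inner slots of
  -- y ∷ z ∷ r, read through y ∷_ when y is a peak.
  sweep-step : ∀ {n} (f V : List ℕ → ℕ) x y z r → All (_< n) (x ∷ y ∷ z ∷ r) → InsertionTransfer n f V →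
    SweepIdentity n f V y (z ∷ r) → SweepIdentity n (f ∘ (y ∷_)) (V ∘ (y ∷_)) y (z ∷ r) →
    SweepIdentity n f V x (y ∷ z ∷ r)
  sweep-step {n} f V x y z r a@(_ ∷ y<n ∷ z<n ∷ a′) tr ih ih-shifted =
    subst₂ Sweep (sym (peaks-∷ x y z r)) (sym (innerSum-∷∷ f V x y z r a tr)) (by-status (isPeak x y z) (isPeak⇒> x y z))
    where
    P′ : List ℕ
    P′ = peaks (y ∷ z ∷ r)

    Sweep : List ℕ → ℕ → Set
    Sweep P I = I + 2 * length P * V P ≡ length (y ∷ z ∷ r) * V P + 2 * ∑ (removals P) V

    rest : (List ℕ → ℕ) → ℕ
    rest g = ∑[ ρ ∈ initInsertions n r ] g (peaks (y ∷ z ∷ ρ))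

    skip : ∀ v I k L S → I + 2 * k * v ≡ L * v + 2 * S → v + I + 2 * k * v ≡ suc L * v + 2 * S
    skip v I k L S eq = trans (rearrange v I k) (trans (cong (v +_) eq) (rearrange′ v L S))
      where
      rearrange : ∀ v I k → v + I + 2 * k * v ≡ v + (I + 2 * k * v)
      rearrange = solve-∀
      rearrange′ : ∀ v L S → v + (L * v + 2 * S) ≡ suc L * v + 2 * S
      rearrange′ = solve-∀

    absorb : ∀ v w S k L Σ → w + S + 2 * k * w ≡ L * w + 2 * Σ → v + (v + S) + 2 * suc k * w ≡ suc L * w + 2 * (v + Σ)
    absorb v w S k L Σ eq = trans (rearrange v w S k) (trans (cong (2 * v + w +_) eq) (rearrange′ v w L Σ))
      where
      rearrange : ∀ v w S k → v + (v + S) + 2 * suc k * w ≡ 2 * v + w + (w + S + 2 * k * w)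
      rearrange = solve-∀
      rearrange′ : ∀ v w L Σ → 2 * v + w + (L * w + 2 * Σ) ≡ suc L * w + 2 * (v + Σ)
      rearrange′ = solve-∀

    by-status : ∀ b → (b ≡ true → z < y) → Sweep (consIf b y P′) (V P′ + (f (peaks (y ∷ n ∷ z ∷ r)) + rest (f ∘ consIf b y)))
    by-status false _ =
      subst (λ I → Sweep P′ (V P′ + I)) (innerSum-∷ n f y z r)
            (skip (V P′) (innerSum n f y (z ∷ r)) (length P′) (length (z ∷ r)) (∑ (removals P′) V) ih)
    by-status true peak = begin
      V P′ + (f (peaks (y ∷ n ∷ z ∷ r)) + rest (f ∘ (y ∷_))) + 2 * suc (length P′) * V (y ∷ P′)
        ≡⟨ cong (λ u → V P′ + (u + rest (f ∘ (y ∷_))) + 2 * suc (length P′) * V (y ∷ P′)) (trans (cong f around) (tr [] P′)) ⟩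
      V P′ + (V P′ + rest (f ∘ (y ∷_))) + 2 * suc (length P′) * V (y ∷ P′)
        ≡⟨ absorb (V P′) (V (y ∷ P′)) (rest (f ∘ (y ∷_))) (length P′) (length (z ∷ r)) (∑ (removals P′) (V ∘ (y ∷_)))
             (trans (cong (λ I → I + 2 * length P′ * V (y ∷ P′)) (sym shifted-first)) ih-shifted) ⟩
      length (y ∷ z ∷ r) * V (y ∷ P′) + 2 * (V P′ + ∑ (removals P′) (V ∘ (y ∷_)))
        ≡⟨ cong (λ u → length (y ∷ z ∷ r) * V (y ∷ P′) + 2 * (V P′ + u)) (∑-map (y ∷_) (removals P′) V) ⟨
      length (y ∷ z ∷ r) * V (y ∷ P′) + 2 * (V P′ + ∑ (map (y ∷_) (removals P′)) V)
        ∎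
      where
      around : peaks (y ∷ n ∷ z ∷ r) ≡ n ∷ P′
      around = trans (peaks-around-max y z r (y<n ∷ z<n ∷ a′)) (cong (n ∷_) (sym (peaks-descent y z r (peak refl))))
      shifted-first : innerSum n (f ∘ (y ∷_)) y (z ∷ r) ≡ V (y ∷ P′) + rest (f ∘ (y ∷_))
      shifted-first = trans (innerSum-∷ n (f ∘ (y ∷_)) y z r)
        (cong (_+ rest (f ∘ (y ∷_))) (trans (cong (f ∘ (y ∷_)) around) (tr (y ∷ []) P′)))

  inner-sweep : ∀ {n} (f V : List ℕ → ℕ) x w → All (_< n) (x ∷ w) → InsertionTransfer n f V → SweepIdentity n f V x w
  inner-sweep f V x []            _ _  = refl
  inner-sweep f V x (y ∷ [])  a tr
    rewrite peaks-around-max x y [] a | tr [] [] = one-slot (V [])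
    where
    one-slot : ∀ v → v + 0 + 2 * 0 * v ≡ 1 * v + 2 * 0
    one-slot = solve-∀
  inner-sweep f V x (y ∷ z ∷ r) a@(_ ∷ a′) tr =
    sweep-step f V x y z r a tr (inner-sweep f V y (z ∷ r) a′ tr)
      (inner-sweep (f ∘ (y ∷_)) (V ∘ (y ∷_)) y (z ∷ r) a′ (λ A B → tr (y ∷ A) B))

  insertion-sum : ∀ {n} (f V : List ℕ → ℕ) x w → All (_< n) (x ∷ w) → InsertionTransfer n f V →
    ∑[ σ ∈ insertions n (x ∷ w) ] f (peaks σ) + 2 * length (peaks (x ∷ w)) * V (peaks (x ∷ w))
      ≡ 2 * f (peaks (x ∷ w)) + (length w * V (peaks (x ∷ w)) + 2 * ∑ (removals (peaks (x ∷ w))) V)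
  insertion-sum {n} f V x w a tr = begin
    ∑[ σ ∈ insertions n (x ∷ w) ] f (peaks σ) + K
      ≡⟨ cong (_+ K) ends ⟩
    f P + (innerSum n f x w + f P) + K
      ≡⟨ rearrange (f P) (innerSum n f x w) K ⟩
    2 * f P + (innerSum n f x w + K)
      ≡⟨ cong (2 * f P +_) (inner-sweep f V x w a tr) ⟩
    2 * f P + (length w * V P + 2 * ∑ (removals P) V)
      ∎
    where
    P : List ℕ
    P = peaks (x ∷ w)
    K : ℕ
    K = 2 * length P * V P
    rearrange : ∀ p i k → p + (i + p) + k ≡ 2 * p + (i + k)
    rearrange = solve-∀
    ends : ∑[ σ ∈ insertions n (x ∷ w) ] f (peaks σ) ≡ f P + (innerSum n f x w + f P)
    ends = begin
      ∑[ σ ∈ insertions n (x ∷ w) ] f (peaks σ)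
        ≡⟨ cong (λ L → ∑[ σ ∈ L ] f (peaks σ)) (insertions-init n (x ∷ w)) ⟩
      f (peaks (n ∷ x ∷ w)) + ∑[ σ ∈ map (x ∷_) (initInsertions n w) ++ ((x ∷ w) ++ n ∷ []) ∷ [] ] f (peaks σ)
        ≡⟨ cong (f (peaks (n ∷ x ∷ w)) +_) (∑-++ (map (x ∷_) (initInsertions n w)) _ (f ∘ peaks)) ⟩
      f (peaks (n ∷ x ∷ w)) + (∑[ σ ∈ map (x ∷_) (initInsertions n w) ] f (peaks σ) + (f (peaks ((x ∷ w) ++ n ∷ [])) + 0))
        ≡⟨ cong₃ (λ u v z → u + (v + z)) (cong f (peaks-max-∷ (x ∷ w) a)) (∑-map (x ∷_) (initInsertions n w) (f ∘ peaks))
                 (trans (+-identityʳ _) (cong f (peaks-∷-max (x ∷ w) a))) ⟩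
      f P + (innerSum n f x w + f P)
        ∎

  -- Peak tallies

  bump : Bool → ℕ × ℕ → ℕ × ℕ
  bump true  (a , b) = suc a , b
  bump false (a , b) = a , suc b

  tally : (ℕ → Bool) → List ℕ → ℕ × ℕ
  tally t []      = 0 , 0
  tally t (p ∷ P) = bump (t p) (tally t P)

  bump-comm : ∀ c d X → bump c (bump d X) ≡ bump d (bump c X)
  bump-comm true  true  X = refl
  bump-comm true  false X = refl
  bump-comm false true  X = refl
  bump-comm false false X = refl

  tally-insert : ∀ t n A B → tally t (A ++ n ∷ B) ≡ bump (t n) (tally t (A ++ B))
  tally-insert t n []      B = refl
  tally-insert t n (p ∷ A) B =
    trans (cong (bump (t p)) (tally-insert t n A B)) (bump-comm (t p) (t n) (tally t (A ++ B)))

  tally-length : ∀ t P → length P ≡ proj₁ (tally t P) + proj₂ (tally t P)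
  tally-length t []      = refl
  tally-length t (p ∷ P) with t p
  ... | true  = cong suc (tally-length t P)
  ... | false = trans (cong suc (tally-length t P)) (sym (+-suc _ _))

  tally-not : ∀ t P → tally (not ∘ t) P ≡ swap (tally t P)
  tally-not t []      = refl
  tally-not t (p ∷ P) with t p
  ... | true  = cong (bump false) (tally-not t P)
  ... | false = cong (bump true) (tally-not t P)

  -- Built from _×-dec_ rather than Data.Product.Properties.≡-dec, so that `does (X ≟² Y)` computes
  -- to a conjunction of _≡ᵇ_ tests; e.g. δ (bump true X) (suc s , u) reduces to δ X (s , u).
  _≟²_ : (X Y : ℕ × ℕ) → Dec (X ≡ Y)
  (a , b) ≟² (s , u) =
    map′ (λ (a≡s , b≡u) → cong₂ _,_ a≡s b≡u) (λ eq → cong proj₁ eq , cong proj₂ eq) ((a ≟ s) ×-dec (b ≟ u))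

  𝟙 : Bool → ℕ
  𝟙 true  = 1
  𝟙 false = 0

  δ : ℕ × ℕ → ℕ × ℕ → ℕ
  δ X Y = 𝟙 (does (X ≟² Y))

  δ-≢ : ∀ X Y → X ≢ Y → δ X Y ≡ 0
  δ-≢ X Y X≢Y = cong 𝟙 (dec-false (X ≟² Y) X≢Y)

  δ-swap : ∀ X Y → δ (swap X) (swap Y) ≡ δ X Y
  δ-swap (a , b) (s , u) = cong 𝟙 (∧-comm (does (b ≟ u)) (does (a ≟ s)))

  δ-weight : ∀ (g : ℕ × ℕ → ℕ) X Y → g X * δ X Y ≡ g Y * δ X Y
  δ-weight g X Y with X ≟² Y
  ... | yes refl = refl
  ... | no X≢Y rewrite δ-≢ X Y X≢Y = trans (*-zeroʳ (g X)) (sym (*-zeroʳ (g Y)))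

  δ-bump-false-zero : ∀ X s → δ (bump false X) (s , 0) ≡ 0
  δ-bump-false-zero X s = δ-≢ (bump false X) (s , 0) (λ ())

  removals-δ : ∀ t P s u →
    ∑[ Q ∈ removals P ] δ (tally t Q) (s , u)
      ≡ suc s * δ (tally t P) (suc s , u) + suc u * δ (tally t P) (s , suc u)
  removals-δ t []      s u =
    sym (cong₂ _+_ (*-zeroʳ (suc s)) (trans (cong (suc u *_) (δ-≢ (0 , 0) (s , suc u) λ ())) (*-zeroʳ (suc u))))
  removals-δ t (p ∷ P) s u =
    trans (cong (δ (tally t P) (s , u) +_) (∑-map (p ∷_) (removals P) _)) (by-test (t p) s u)
    where
    P̂ : ℕ × ℕ
    P̂ = tally t P
    by-test : ∀ c s u → δ P̂ (s , u) + ∑[ Q ∈ removals P ] δ (bump c (tally t Q)) (s , u)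
                      ≡ suc s * δ (bump c P̂) (suc s , u) + suc u * δ (bump c P̂) (s , suc u)
    by-test true zero u =
      trans (cong (δ P̂ (0 , u) +_) (∑-zero (removals P))) (only-kept (δ P̂ (0 , u)) u)
      where
      only-kept : ∀ v u → v + 0 ≡ 1 * v + suc u * 0
      only-kept = solve-∀
    by-test true (suc s) u =
      trans (cong (δ P̂ (suc s , u) +_) (removals-δ t P s u)) (sym (+-assoc (δ P̂ (suc s , u)) _ _))
    by-test false s zero =
      trans (cong (δ P̂ (s , 0) +_) (trans (∑-cong (removals P) (λ {Q} _ → δ-bump-false-zero (tally t Q) s)) (∑-zero (removals P))))
            (trans (only-kept (δ P̂ (s , 0)) s) (cong (λ z → suc s * z + 1 * δ P̂ (s , 0)) (sym (δ-bump-false-zero P̂ (suc s)))))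
      where
      only-kept : ∀ v s → v + 0 ≡ suc s * 0 + 1 * v
      only-kept = solve-∀
    by-test false s (suc u) =
      trans (cong (δ P̂ (s , suc u) +_) (removals-δ t P s u)) (regroup (δ P̂ (s , suc u)) (suc s * δ P̂ (suc s , u)) u)
      where
      regroup : ∀ w x u → w + (x + suc u * w) ≡ x + suc (suc u) * w
      regroup = solve-∀

  -- Counting permutations by peak tally

  count : (ℕ → Bool) → ℕ → ℕ × ℕ → ℕ
  count t m Y = ∑[ τ ∈ permutations m ] δ (tally t (peaks τ)) Y

  count-suc : ∀ t m Y → count t (suc m) Y ≡ ∑[ τ ∈ permutations m ] ∑[ σ ∈ insertions (suc m) τ ] δ (tally t (peaks σ)) Y
  count-suc t m Y = ∑-concatMap (insertions (suc m)) (permutations m) _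

  count-not : ∀ t m X → count (not ∘ t) m (swap X) ≡ count t m X
  count-not t m X = ∑-cong (permutations m) λ {τ} _ →
    trans (cong (λ Z → δ Z (swap X)) (tally-not t (peaks τ))) (δ-swap (tally t (peaks τ)) X)

  ∑-permutations-cong : ∀ k {F G : List ℕ → ℕ} →
    (∀ x w → All (_< suc (suc k)) (x ∷ w) → length w ≡ k → F (x ∷ w) ≡ G (x ∷ w)) →
    ∑ (permutations (suc k)) F ≡ ∑ (permutations (suc k)) G
  ∑-permutations-cong k {F} {G} F≗G =
    ∑-cong (permutations (suc k)) λ {τ} τ∈ → shape τ (permutations-bounded (suc k) τ∈) (length-τ τ∈)
    where
    length-τ : ∀ {τ} → τ ∈ permutations (suc k) → length τ ≡ suc k
    length-τ τ∈ = trans (↭-length (∈-permutations⁻ (suc k) τ∈)) (trans (length-map suc (upTo (suc k))) (length-upTo (suc k)))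
    shape : ∀ τ → All (_< suc (suc k)) τ → length τ ≡ suc k → F τ ≡ G τ
    shape (x ∷ w) bounded len = F≗G x w bounded (suc-injective len)

  ∑-lin : {A : Set} (xs : List A) (a b : ℕ) (f g : A → ℕ) → ∑[ x ∈ xs ] (a * f x + b * g x) ≡ a * ∑ xs f + b * ∑ xs g
  ∑-lin xs a b f g = trans (∑-+ xs _ _) (cong₂ _+_ (∑-*ˡ a xs f) (∑-*ˡ b xs g))

  module _ (t : ℕ → Bool) {n : ℕ} (t[n] : t n ≡ false) {x w} (bounded : All (_< n) (x ∷ w)) where
    private
      P : List ℕ
      P = peaks (x ∷ w)
      P̂ : ℕ × ℕ
      P̂ = tally t P

      tally-insert-fresh : ∀ A B → tally t (A ++ n ∷ B) ≡ bump false (tally t (A ++ B))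
      tally-insert-fresh A B = trans (tally-insert t n A B) (cong (λ c → bump c (tally t (A ++ B))) t[n])

    insertions-fresh-zero : ∀ s → ∑[ σ ∈ insertions n (x ∷ w) ] δ (tally t (peaks σ)) (s , 0) ≡ 2 * δ P̂ (s , 0)
    insertions-fresh-zero s = begin
      Σ                                                      ≡⟨ trans (cong (Σ +_) (*-zeroʳ (2 * length P))) (+-identityʳ Σ) ⟨
      Σ + 2 * length P * 0                                   ≡⟨ insertion-sum (λ Q → δ (tally t Q) (s , 0)) (λ _ → 0) x w bounded tr ⟩
      2 * δ P̂ (s , 0) + (length w * 0 + 2 * ∑[ Q ∈ removals P ] 0)
        ≡⟨ cong₂ (λ a b → 2 * δ P̂ (s , 0) + (a + 2 * b)) (*-zeroʳ (length w)) (∑-zero (removals P)) ⟩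
      2 * δ P̂ (s , 0) + 0                                    ≡⟨ +-identityʳ _ ⟩
      2 * δ P̂ (s , 0)                                        ∎
      where
      Σ : ℕ
      Σ = ∑[ σ ∈ insertions n (x ∷ w) ] δ (tally t (peaks σ)) (s , 0)
      tr : InsertionTransfer n (λ P → δ (tally t P) (s , 0)) (λ _ → 0)
      tr A B = trans (cong (λ Z → δ Z (s , 0)) (tally-insert-fresh A B)) (δ-bump-false-zero (tally t (A ++ B)) s)

    insertions-fresh-suc : ∀ s u →
      ∑[ σ ∈ insertions n (x ∷ w) ] δ (tally t (peaks σ)) (s , suc u) + 2 * (s + u) * δ P̂ (s , u)
        ≡ 2 * δ P̂ (s , suc u) + (length w * δ P̂ (s , u) + 2 * (suc s * δ P̂ (suc s , u) + suc u * δ P̂ (s , suc u)))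
    insertions-fresh-suc s u = begin
      Σ + 2 * (s + u) * δ P̂ (s , u)
        ≡⟨ cong (Σ +_) weight ⟨
      Σ + 2 * length P * δ P̂ (s , u)
        ≡⟨ insertion-sum (λ Q → δ (tally t Q) (s , suc u)) (λ R → δ (tally t R) (s , u)) x w bounded tr ⟩
      2 * δ P̂ (s , suc u) + (length w * δ P̂ (s , u) + 2 * ∑[ Q ∈ removals P ] δ (tally t Q) (s , u))
        ≡⟨ cong (λ z → 2 * δ P̂ (s , suc u) + (length w * δ P̂ (s , u) + 2 * z)) (removals-δ t P s u) ⟩
      2 * δ P̂ (s , suc u) + (length w * δ P̂ (s , u) + 2 * (suc s * δ P̂ (suc s , u) + suc u * δ P̂ (s , suc u)))
        ∎
      where
      Σ : ℕ
      Σ = ∑[ σ ∈ insertions n (x ∷ w) ] δ (tally t (peaks σ)) (s , suc u)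
      tr : InsertionTransfer n (λ P → δ (tally t P) (s , suc u)) (λ R → δ (tally t R) (s , u))
      tr A B = cong (λ Z → δ Z (s , suc u)) (tally-insert-fresh A B)
      weight : 2 * length P * δ P̂ (s , u) ≡ 2 * (s + u) * δ P̂ (s , u)
      weight = trans (cong (λ L → 2 * L * δ P̂ (s , u)) (tally-length t P))
                     (δ-weight (λ X → 2 * (proj₁ X + proj₂ X)) P̂ (s , u))

  module _ (t : ℕ → Bool) (k : ℕ) (t[n] : t (2 + k) ≡ false) where
    private
      perms : List (List ℕ)
      perms = permutations (suc k)
      N : ℕ × ℕ → ℕ
      N = count t (suc k)
      δ̂ : ℕ × ℕ → List ℕ → ℕ
      δ̂ Y τ = δ (tally t (peaks τ)) Y

    count-fresh-zero : ∀ s → count t (2 + k) (s , 0) ≡ 2 * N (s , 0)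
    count-fresh-zero s = begin
      count t (2 + k) (s , 0)
        ≡⟨ count-suc t (suc k) (s , 0) ⟩
      ∑[ τ ∈ perms ] ∑[ σ ∈ insertions (2 + k) τ ] δ̂ (s , 0) σ
        ≡⟨ ∑-permutations-cong k (λ x w bounded _ → insertions-fresh-zero t t[n] bounded s) ⟩
      ∑[ τ ∈ perms ] (2 * δ̂ (s , 0) τ)
        ≡⟨ ∑-*ˡ 2 perms (δ̂ (s , 0)) ⟩
      2 * N (s , 0)
        ∎

    count-fresh-suc : ∀ s u →
      count t (2 + k) (s , suc u) + 2 * (s + u) * N (s , u)
        ≡ 2 * N (s , suc u) + (k * N (s , u) + 2 * (suc s * N (suc s , u) + suc u * N (s , suc u)))
    count-fresh-suc s u = begin
      count t (2 + k) (s , suc u) + 2 * (s + u) * N (s , u)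
        ≡⟨ cong₂ _+_ (count-suc t (suc k) (s , suc u)) (sym (∑-*ˡ (2 * (s + u)) perms (δ̂ (s , u)))) ⟩
      ∑[ τ ∈ perms ] ∑[ σ ∈ insertions (2 + k) τ ] δ̂ (s , suc u) σ + ∑[ τ ∈ perms ] (2 * (s + u) * δ̂ (s , u) τ)
        ≡⟨ ∑-+ perms _ _ ⟨
      ∑[ τ ∈ perms ] (∑[ σ ∈ insertions (2 + k) τ ] δ̂ (s , suc u) σ + 2 * (s + u) * δ̂ (s , u) τ)
        ≡⟨ ∑-permutations-cong k per-permutation ⟩
      ∑[ τ ∈ perms ] (2 * δ̂ (s , suc u) τ + (k * δ̂ (s , u) τ + 2 * (suc s * δ̂ (suc s , u) τ + suc u * δ̂ (s , suc u) τ)))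
        ≡⟨ trans (∑-+ perms _ _) (cong₂ _+_ (∑-*ˡ 2 perms _) (trans (∑-+ perms _ _)
             (cong₂ _+_ (∑-*ˡ k perms _) (trans (∑-*ˡ 2 perms _) (cong (2 *_) (∑-lin perms (suc s) (suc u) _ _)))))) ⟩
      2 * N (s , suc u) + (k * N (s , u) + 2 * (suc s * N (suc s , u) + suc u * N (s , suc u)))
        ∎
      where
      per-permutation : ∀ x w → All (_< 2 + k) (x ∷ w) → length w ≡ k →
        ∑[ σ ∈ insertions (2 + k) (x ∷ w) ] δ̂ (s , suc u) σ + 2 * (s + u) * δ̂ (s , u) (x ∷ w)
          ≡ 2 * δ̂ (s , suc u) (x ∷ w)
            + (k * δ̂ (s , u) (x ∷ w) + 2 * (suc s * δ̂ (suc s , u) (x ∷ w) + suc u * δ̂ (s , suc u) (x ∷ w)))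
      per-permutation x w bounded refl = insertions-fresh-suc t t[n] bounded s u

  -- A new maximum passing the test is a new maximum failing the test not ∘ t.
  module _ (t : ℕ → Bool) (k : ℕ) (t[n] : t (2 + k) ≡ true) where
    private
      N : ℕ × ℕ → ℕ
      N = count t (suc k)
      t̄[n] : not (t (2 + k)) ≡ false
      t̄[n] = cong not t[n]

    count-target-zero : ∀ u → count t (2 + k) (0 , u) ≡ 2 * N (0 , u)
    count-target-zero u =
      trans (sym (count-not t (2 + k) (0 , u)))
            (trans (count-fresh-zero (not ∘ t) k t̄[n] u) (cong (2 *_) (count-not t (suc k) (0 , u))))

    count-target-suc : ∀ s u →
      count t (2 + k) (suc s , u) + 2 * (u + s) * N (s , u)
        ≡ 2 * N (suc s , u) + (k * N (s , u) + 2 * (suc u * N (s , suc u) + suc s * N (suc s , u)))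
    count-target-suc s u =
      trans (cong₂ (λ a b → a + 2 * (u + s) * b) (sym (count-not t (2 + k) (suc s , u))) (sym (count-not t (suc k) (s , u))))
        (trans (count-fresh-suc (not ∘ t) k t̄[n] u s)
          (recombine (count-not t (suc k) (suc s , u)) (count-not t (suc k) (s , u))
                     (count-not t (suc k) (s , suc u)) (count-not t (suc k) (suc s , u))))
      where
      recombine : ∀ {a b c d a′ b′ c′ d′} → a ≡ a′ → b ≡ b′ → c ≡ c′ → d ≡ d′ →
        2 * a + (k * b + 2 * (suc u * c + suc s * d)) ≡ 2 * a′ + (k * b′ + 2 * (suc u * c′ + suc s * d′))
      recombine refl refl refl refl = refl

  peaks-⊆ : ∀ x w → peaks (x ∷ w) ⊆ w
  peaks-⊆ x []          = []
  peaks-⊆ x (y ∷ [])    = y ∷ʳ []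
  peaks-⊆ x (y ∷ z ∷ r) = subst (_⊆ y ∷ z ∷ r) (sym (peaks-∷ x y z r)) (consIf-⊆ (isPeak x y z) (peaks-⊆ y (z ∷ r)))
    where
    consIf-⊆ : ∀ {P w} b → P ⊆ w → consIf b y P ⊆ y ∷ w
    consIf-⊆ true  P⊆w = refl ∷ P⊆w
    consIf-⊆ false P⊆w = y ∷ʳ P⊆w

  Unique-resp-⊆ : ∀ {xs ys : List ℕ} → xs ⊆ ys → Unique ys → Unique xs
  Unique-resp-⊆ []          []        = []
  Unique-resp-⊆ (y ∷ʳ xs⊆)  (_ ∷ u)   = Unique-resp-⊆ xs⊆ u
  Unique-resp-⊆ (refl ∷ xs⊆) (y∉ ∷ u) = All-resp-⊆ xs⊆ y∉ ∷ Unique-resp-⊆ xs⊆ u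

  peaks-unique : ∀ τ → Unique τ → Unique (peaks τ)
  peaks-unique []      _ = []
  peaks-unique (x ∷ w) u = Unique-resp-⊆ (x ∷ʳ peaks-⊆ x w) u

  peaks-All : ∀ {P : ℕ → Set} τ → All P τ → All P (peaks τ)
  peaks-All []      _       = []
  peaks-All (x ∷ w) (_ ∷ a) = All-resp-⊆ (peaks-⊆ x w) a

  NoTargetUpTo : (ℕ → Bool) → ℕ → Set
  NoTargetUpTo t m = ∀ {x} → x ≤ m → t x ≡ false

  OneTargetUpTo : (ℕ → Bool) → ℕ → ℕ → Set
  OneTargetUpTo t i m = ∀ {x} → x ≤ m → t x ≡ true → x ≡ i

  one-target-elsewhere : ∀ {t i m x} → OneTargetUpTo t i m → x ≤ m → x ≢ i → t x ≡ false
  one-target-elsewhere {t} {x = x} one x≤m x≢i with t x in t[x]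
  ... | false = refl
  ... | true  = ⊥-elim (x≢i (one x≤m t[x]))

  one-target-restrict : ∀ {t i m m′} → OneTargetUpTo t i m → m′ ≤ m → OneTargetUpTo t i m′
  one-target-restrict one m′≤m x≤m′ = one (≤-trans x≤m′ m′≤m)

  one-target-below : ∀ {t m M} → OneTargetUpTo t (suc m) M → m ≤ M → NoTargetUpTo t m
  one-target-below one m≤M x≤m = one-target-elsewhere one (≤-trans x≤m m≤M) (λ { refl → <-irrefl refl x≤m })

  tally-no-target : ∀ t P → All (λ x → t x ≡ false) P → proj₁ (tally t P) ≡ 0
  tally-no-target t []      []        = refl
  tally-no-target t (p ∷ P) (t[p] ∷ a) rewrite t[p] = tally-no-target t P a

  tally-one-target : ∀ t i P → Unique P → All (λ x → t x ≡ true → x ≡ i) P → proj₁ (tally t P) ≤ 1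
  tally-one-target t i []      _          _          = z≤n
  tally-one-target t i (p ∷ P) (p∉ ∷ u) (only-i ∷ a) with t p
  ... | true  = s≤s (≤-reflexive (tally-no-target t P (All.zipWith other (p∉ , a))))
    where
    other : ∀ {x} → p ≢ x × (t x ≡ true → x ≡ i) → t x ≡ false
    other {x} (p≢x , x-only-i) with t x
    ... | false = refl
    ... | true  = ⊥-elim (p≢x (trans (only-i refl) (sym (x-only-i refl))))
  ... | false = tally-one-target t i P u a

  count-vanishes : ∀ t m Y → (∀ {τ} → τ ∈ permutations m → tally t (peaks τ) ≢ Y) → count t m Y ≡ 0
  count-vanishes t m Y ≢Y = trans (∑-cong (permutations m) (λ {τ} τ∈ → δ-≢ _ Y (≢Y τ∈))) (∑-zero (permutations m))

  count-no-target : ∀ t m s u → NoTargetUpTo t m → count t m (suc s , u) ≡ 0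
  count-no-target t m s u none = count-vanishes t m (suc s , u) λ {τ} τ∈ eq →
    case trans (sym (cong proj₁ eq))
               (tally-no-target t (peaks τ) (peaks-All τ (All.map (none ∘ s≤s⁻¹) (permutations-bounded m τ∈)))) of λ ()

  count-one-target : ∀ t i m s u → OneTargetUpTo t i m → count t m (2 + s , u) ≡ 0
  count-one-target t i m s u one = count-vanishes t m (2 + s , u) λ {τ} τ∈ eq →
    case subst (_≤ 1) (cong proj₁ eq)
           (tally-one-target t i (peaks τ) (peaks-unique τ (permutations-unique-entries m τ∈))
             (peaks-All τ (All.map (one ∘ s≤s⁻¹) (permutations-bounded m τ∈)))) of λ { (s≤s ()) }

  -- Peak sets as tallies

  length-filter : ∀ {A : Set} {P : A → Set} (P? : ∀ x → Dec (P x)) xs → length (filter P? xs) ≡ ∑[ x ∈ xs ] 𝟙 (does (P? x))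
  length-filter P? []       = refl
  length-filter P? (x ∷ xs) with does (P? x)
  ... | true  = cong suc (length-filter P? xs)
  ... | false = length-filter P? xs

  cp-count : ∀ n S t Y → (∀ {σ} → IsPerm n σ → CP-is σ S ⇔ (tally t (peaks σ) ≡ Y)) → cp n S (count t n Y)
  cp-count n S t Y characterisation =
    L , Unique.filter⁺ P? (permutations-unique n) , All.tabulate sound , complete , length-filter P? (permutations n)
    where
    P? : ∀ σ → Dec (tally t (peaks σ) ≡ Y)
    P? σ = tally t (peaks σ) ≟² Y
    L : List (List ℕ)
    L = filter P? (permutations n)
    sound : ∀ {σ} → σ ∈ L → InCP n S σ
    sound σ∈ with σ∈perms , has-Y ← ∈-filter⁻ P? σ∈ =
      ∈-permutations⁻ n σ∈perms , Equivalence.from (characterisation (∈-permutations⁻ n σ∈perms)) has-Y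
    complete : ∀ σ → InCP n S σ → σ ∈ L
    complete σ (perm , peak-set) = ∈-filter⁺ P? (∈-permutations⁺ n perm) (Equivalence.to (characterisation perm) peak-set)

  ∈-shrink : ∀ {x q} {S S′ : List ℕ} → S ↭ x ∷ S′ → q ∈ S → x ≢ q → q ∈ S′
  ∈-shrink S↭ q∈ x≢q with ∈-resp-↭ S↭ q∈
  ... | here q≡x  = ⊥-elim (x≢q (sym q≡x))
  ... | there q∈′ = q∈′

  ∈-extract : ∀ {x} {S : List ℕ} → x ∈ S → ∃[ S′ ] (S ↭ x ∷ S′)
  ∈-extract x∈ with A , B , refl ← ∈-∃++ x∈ = A ++ B , shift _ A B

  unique-length-≤ : ∀ {P S : List ℕ} → Unique P → All (_∈ S) P → length P ≤ length S
  unique-length-≤ {[]}    _          _          = z≤n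
  unique-length-≤ {p ∷ P} (p∉ ∷ u) (p∈ ∷ a) with S′ , S↭ ← ∈-extract p∈ =
    subst (suc (length P) ≤_) (sym (↭-length S↭))
          (s≤s (unique-length-≤ u (All.zipWith (λ (p≢q , q∈) → ∈-shrink S↭ q∈ p≢q) (p∉ , a))))

  unique-saturates : ∀ {P S : List ℕ} → Unique P → All (_∈ S) P → length S ≤ length P → ∀ {x} → x ∈ S → x ∈ P
  unique-saturates {P} u a |S|≤|P| {x} x∈S with x ∈? P
  ... | yes x∈P = x∈P
  ... | no  x∉P with S′ , S↭ ← ∈-extract x∈S =
    ⊥-elim (<-irrefl refl (≤-trans (subst (_≤ length P) (↭-length S↭) |S|≤|P|) (unique-length-≤ u inside-S′)))
    where
    inside-S′ : All (_∈ S′) P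
    inside-S′ = All.tabulate λ {q} q∈P → ∈-shrink S↭ (All.lookup a q∈P) (λ { refl → x∉P q∈P })

  tally-all : ∀ t P → All (λ x → t x ≡ true) P → tally t P ≡ (length P , 0)
  tally-all t []      []         = refl
  tally-all t (p ∷ P) (t[p] ∷ a) rewrite t[p] = cong (bump true) (tally-all t P a)

  tally-snd-zero : ∀ t P → proj₂ (tally t P) ≡ 0 → All (λ x → t x ≡ true) P
  tally-snd-zero t []      _  = []
  tally-snd-zero t (p ∷ P) eq with t p in t[p]
  ... | true  = t[p] ∷ tally-snd-zero t P eq
  ... | false = case eq of λ ()

  _∈ᵇ_ : ℕ → List ℕ → Bool
  x ∈ᵇ S = does (x ∈? S)

  ∈ᵇ⇒∈ : ∀ {x S} → x ∈ᵇ S ≡ true → x ∈ S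
  ∈ᵇ⇒∈ {x} {S} eq with x ∈? S
  ... | yes x∈ = x∈

  sameElements⇔tally : ∀ S P → Unique S → Unique P →
    (∀ x → (x ∈ P) ⇔ (x ∈ S)) ⇔ (tally (_∈ᵇ S) P ≡ (length S , 0))
  sameElements⇔tally S P uS uP = mk⇔ to from
    where
    to : (∀ x → (x ∈ P) ⇔ (x ∈ S)) → tally (_∈ᵇ S) P ≡ (length S , 0)
    to same = trans (tally-all (_∈ᵇ S) P (All.map (dec-true (_ ∈? S)) P⊆S)) (cong (_, 0) (≤-antisym
        (unique-length-≤ uP P⊆S) (unique-length-≤ uS (All.tabulate (Equivalence.from (same _))))))
      where
      P⊆S : All (_∈ S) P
      P⊆S = All.tabulate (Equivalence.to (same _))
    from : tally (_∈ᵇ S) P ≡ (length S , 0) → ∀ x → (x ∈ P) ⇔ (x ∈ S)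
    from eq x = mk⇔ (All.lookup P⊆S) (unique-saturates uP P⊆S (≤-reflexive |S|≡|P|))
      where
      P⊆S : All (_∈ S) P
      P⊆S = All.map ∈ᵇ⇒∈ (tally-snd-zero (_∈ᵇ S) P (cong proj₂ eq))
      |S|≡|P| : length S ≡ length P
      |S|≡|P| = sym (trans (tally-length (_∈ᵇ S) P) (trans (cong (λ X → proj₁ X + proj₂ X) eq) (+-identityʳ _)))

  cp-peak-set : ∀ n S → Unique S → cp n S (count (_∈ᵇ S) n (length S , 0))
  cp-peak-set n S uS = cp-count n S (_∈ᵇ S) (length S , 0) λ {σ} perm →
    sameElements⇔tally S (peaks σ) uS (peaks-unique σ (Unique-resp-↭ (↭-sym perm) ([]-unique n)))

  -- Tallies with at most two peaks

  count-empty : ∀ t k → count t (suc k) (0 , 0) ≡ 2 ^ k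
  count-empty t zero    = refl
  count-empty t (suc k) with t (2 + k) in t[n]
  ... | false = trans (count-fresh-zero t k t[n] 0) (cong (2 *_) (count-empty t k))
  ... | true  = trans (count-target-zero t k t[n] 0) (cong (2 *_) (count-empty t k))

  module _ (t : ℕ → Bool) (k : ℕ) where
    private
      N : ℕ × ℕ → ℕ
      N = count t (suc k)
      N′ : ℕ × ℕ → ℕ
      N′ = count t (2 + k)

    count-one-peak-step : NoTargetUpTo t (2 + k) → N′ (0 , 1) ≡ 4 * N (0 , 1) + k * 2 ^ k
    count-one-peak-step none = begin
      N′ (0 , 1)                                                ≡⟨ +-identityʳ _ ⟨
      N′ (0 , 1) + 2 * (0 + 0) * N (0 , 0)                      ≡⟨ count-fresh-suc t k (none ≤-refl) 0 0 ⟩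
      2 * N (0 , 1) + (k * N (0 , 0) + 2 * (1 * N (1 , 0) + 1 * N (0 , 1)))
        ≡⟨ cong₂ (λ e z → 2 * N (0 , 1) + (k * e + 2 * (1 * z + 1 * N (0 , 1))))
                 (count-empty t k) (count-no-target t (suc k) 0 0 (none ∘ m≤n⇒m≤1+n)) ⟩
      2 * N (0 , 1) + (k * 2 ^ k + 2 * (1 * 0 + 1 * N (0 , 1))) ≡⟨ regroup (N (0 , 1)) (k * 2 ^ k) ⟩
      4 * N (0 , 1) + k * 2 ^ k                                 ∎
      where
      regroup : ∀ a e → 2 * a + (e + 2 * (1 * 0 + 1 * a)) ≡ 4 * a + e
      regroup = solve-∀

    count-two-peaks-step : NoTargetUpTo t (2 + k) → N′ (0 , 2) + 2 * N (0 , 1) ≡ 6 * N (0 , 2) + k * N (0 , 1)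
    count-two-peaks-step none = begin
      N′ (0 , 2) + 2 * N (0 , 1)                                ≡⟨ count-fresh-suc t k (none ≤-refl) 0 1 ⟩
      2 * N (0 , 2) + (k * N (0 , 1) + 2 * (1 * N (1 , 1) + 2 * N (0 , 2)))
        ≡⟨ cong (λ z → 2 * N (0 , 2) + (k * N (0 , 1) + 2 * (1 * z + 2 * N (0 , 2))))
                (count-no-target t (suc k) 0 1 (none ∘ m≤n⇒m≤1+n)) ⟩
      2 * N (0 , 2) + (k * N (0 , 1) + 2 * (1 * 0 + 2 * N (0 , 2))) ≡⟨ regroup (N (0 , 2)) (k * N (0 , 1)) ⟩
      6 * N (0 , 2) + k * N (0 , 1)                             ∎
      where
      regroup : ∀ a e → 2 * a + (e + 2 * (1 * 0 + 2 * a)) ≡ 6 * a + e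
      regroup = solve-∀

    count-first-target-step : t (2 + k) ≡ true → NoTargetUpTo t (suc k) → N′ (1 , 0) ≡ k * 2 ^ k + 2 * N (0 , 1)
    count-first-target-step t[n] none = begin
      N′ (1 , 0)                                                ≡⟨ +-identityʳ _ ⟨
      N′ (1 , 0) + 2 * (0 + 0) * N (0 , 0)                      ≡⟨ count-target-suc t k t[n] 0 0 ⟩
      2 * N (1 , 0) + (k * N (0 , 0) + 2 * (1 * N (0 , 1) + 1 * N (1 , 0)))
        ≡⟨ cong₂ (λ z e → 2 * z + (k * e + 2 * (1 * N (0 , 1) + 1 * z))) (count-no-target t (suc k) 0 0 none) (count-empty t k) ⟩
      2 * 0 + (k * 2 ^ k + 2 * (1 * N (0 , 1) + 1 * 0))         ≡⟨ regroup (N (0 , 1)) (k * 2 ^ k) ⟩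
      k * 2 ^ k + 2 * N (0 , 1)                                 ∎
      where
      regroup : ∀ a e → 2 * 0 + (e + 2 * (1 * a + 1 * 0)) ≡ e + 2 * a
      regroup = solve-∀

    count-first-target-pair-step : t (2 + k) ≡ true → NoTargetUpTo t (suc k) →
      N′ (1 , 1) + 2 * N (0 , 1) ≡ k * N (0 , 1) + 4 * N (0 , 2)
    count-first-target-pair-step t[n] none = begin
      N′ (1 , 1) + 2 * N (0 , 1)                                ≡⟨ cong (λ z → N′ (1 , 1) + 2 * z * N (0 , 1)) (+-identityʳ 1) ⟨
      N′ (1 , 1) + 2 * (1 + 0) * N (0 , 1)                      ≡⟨ count-target-suc t k t[n] 0 1 ⟩
      2 * N (1 , 1) + (k * N (0 , 1) + 2 * (2 * N (0 , 2) + 1 * N (1 , 1)))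
        ≡⟨ cong (λ z → 2 * z + (k * N (0 , 1) + 2 * (2 * N (0 , 2) + 1 * z))) (count-no-target t (suc k) 0 1 none) ⟩
      2 * 0 + (k * N (0 , 1) + 2 * (2 * N (0 , 2) + 1 * 0))     ≡⟨ regroup (N (0 , 2)) (k * N (0 , 1)) ⟩
      k * N (0 , 1) + 4 * N (0 , 2)                             ∎
      where
      regroup : ∀ a e → 2 * 0 + (e + 2 * (2 * a + 1 * 0)) ≡ e + 4 * a
      regroup = solve-∀

    count-target-pair-fresh-step : ∀ i → t (2 + k) ≡ false → OneTargetUpTo t i (suc k) →
      N′ (1 , 1) + 2 * N (1 , 0) ≡ 4 * N (1 , 1) + k * N (1 , 0)
    count-target-pair-fresh-step i t[n] one = begin
      N′ (1 , 1) + 2 * N (1 , 0)                                ≡⟨ cong (λ z → N′ (1 , 1) + 2 * z * N (1 , 0)) (+-identityʳ 1) ⟨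
      N′ (1 , 1) + 2 * (1 + 0) * N (1 , 0)                      ≡⟨ count-fresh-suc t k t[n] 1 0 ⟩
      2 * N (1 , 1) + (k * N (1 , 0) + 2 * (2 * N (2 , 0) + 1 * N (1 , 1)))
        ≡⟨ cong (λ z → 2 * N (1 , 1) + (k * N (1 , 0) + 2 * (2 * z + 1 * N (1 , 1)))) (count-one-target t i (suc k) 0 0 one) ⟩
      2 * N (1 , 1) + (k * N (1 , 0) + 2 * (2 * 0 + 1 * N (1 , 1))) ≡⟨ regroup (N (1 , 1)) (k * N (1 , 0)) ⟩
      4 * N (1 , 1) + k * N (1 , 0)                             ∎
      where
      regroup : ∀ a e → 2 * a + (e + 2 * (2 * 0 + 1 * a)) ≡ 4 * a + e
      regroup = solve-∀

    count-second-target-step : ∀ i → t (2 + k) ≡ true → OneTargetUpTo t i (suc k) →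
      N′ (2 , 0) + 2 * N (1 , 0) ≡ k * N (1 , 0) + 2 * N (1 , 1)
    count-second-target-step i t[n] one = begin
      N′ (2 , 0) + 2 * N (1 , 0)                                ≡⟨ cong (λ z → N′ (2 , 0) + 2 * z * N (1 , 0)) (+-comm 0 1) ⟨
      N′ (2 , 0) + 2 * (0 + 1) * N (1 , 0)                      ≡⟨ count-target-suc t k t[n] 1 0 ⟩
      2 * N (2 , 0) + (k * N (1 , 0) + 2 * (1 * N (1 , 1) + 2 * N (2 , 0)))
        ≡⟨ cong (λ z → 2 * z + (k * N (1 , 0) + 2 * (1 * N (1 , 1) + 2 * z))) (count-one-target t i (suc k) 0 0 one) ⟩
      2 * 0 + (k * N (1 , 0) + 2 * (1 * N (1 , 1) + 2 * 0))     ≡⟨ regroup (N (1 , 1)) (k * N (1 , 0)) ⟩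
      k * N (1 , 0) + 2 * N (1 , 1)                             ∎
      where
      regroup : ∀ a e → 2 * 0 + (e + 2 * (1 * a + 2 * 0)) ≡ e + 2 * a
      regroup = solve-∀

  ∈ᵇ-head : ∀ x S → x ∈ᵇ (x ∷ S) ≡ true
  ∈ᵇ-head x S = dec-true (x ∈? (x ∷ S)) (here refl)

  ∈ᵇ-second : ∀ x y → y ∈ᵇ (x ∷ y ∷ []) ≡ true
  ∈ᵇ-second x y = dec-true (y ∈? (x ∷ y ∷ [])) (there (here refl))

  one-target-singleton : ∀ i m → OneTargetUpTo (_∈ᵇ (i ∷ [])) i m
  one-target-singleton i m {x} _ eq with ∈ᵇ⇒∈ {x} {i ∷ []} eq
  ... | here x≡i = x≡i

  one-target-pair : ∀ {i j m} → m < j → OneTargetUpTo (_∈ᵇ (i ∷ j ∷ [])) i m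
  one-target-pair {i} {j} m<j {x} x≤m eq with ∈ᵇ⇒∈ {x} {i ∷ j ∷ []} eq
  ... | here x≡i            = x≡i
  ... | there (here refl)  = ⊥-elim (<-irrefl refl (≤-trans (s≤s x≤m) m<j))

  above-pair : ∀ {i j x} → i < j → j < x → x ∈ᵇ (i ∷ j ∷ []) ≡ false
  above-pair {i} {j} {x} i<j j<x = dec-false (x ∈? (i ∷ j ∷ [])) λ
    { (here refl)         → <-irrefl refl (<-trans i<j j<x)
    ; (there (here refl)) → <-irrefl refl j<x }

  -- The last truncated subtraction in part (3) never truncates.
  2^≤3^+1 : ∀ a → 2 ^ (2 + a) ≤ 3 ^ suc a + 1
  2^≤3^+1 zero    = ≤-refl
  2^≤3^+1 (suc a) = ≤-trans (*-monoʳ-≤ 2 (2^≤3^+1 a)) (double≤triple (3 ^ suc a) (m^n>0 3 (suc a)))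
    where
    double≤triple : ∀ x → 1 ≤ x → 2 * (x + 1) ≤ 3 * x + 1
    double≤triple (suc x) _ = ≤-trans (m≤m+n _ x) (≤-reflexive (spare x))
      where
      spare : ∀ x → 2 * (suc x + 1) + x ≡ 3 * suc x + 1
      spare = solve-∀

  level-shift : ∀ k m {n} → k + m ≤ n → n ≡ k + (n ∸ (k + m) + m)
  level-shift k m {n} le = trans (sym (m∸n+n≡m le)) (regroup (n ∸ (k + m)) k m)
    where
    regroup : ∀ b k m → b + (k + m) ≡ k + (b + m)
    regroup = solve-∀

  exponent-gap : ∀ q a → 3 + (q + suc a) ∸ (3 + a) ∸ 1 ≡ q
  exponent-gap q a = cong (_∸ 1) (trans (cong (_∸ a) (+-suc q a)) (m+n∸n≡m (suc q) a))

  exponent-span : ∀ c q a → 3 + (c + (q + suc a)) + (3 + (q + suc a)) ∸ (3 + a) ∸ 5 ≡ c + (q + (q + a))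
  exponent-span c q a = cong (_∸ 5) (trans (cong (_∸ (3 + a)) (split c q a)) (m+n∸m≡n (3 + a) _))
    where
    split : ∀ c q a → 3 + (c + (q + suc a)) + (3 + (q + suc a)) ≡ 3 + a + (5 + (c + (q + (q + a))))
    split = solve-∀

module ClosedForms where

  open PeakTallies
  import Data.Nat as ℕ
  import Data.Nat.Properties as ℕP
  open import Data.Nat using (ℕ; zero; suc; _≤_; _<_; s≤s)
  open import Data.Integer using (ℤ; +_; _+_; _-_; _*_)
  open import Data.Integer.Properties
    using (pos-+; pos-*; +-injective; *-assoc; *-identityˡ; *-cancelˡ-≡; ⊖-≥; m-n≡m⊖n)
  open import Data.Integer.Tactic.RingSolver using (solve-∀)
  open import Data.Bool using (Bool; true; false)
  open import Data.List using ([]; _∷_)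
  open import Data.Product using (_,_)
  open import Function using (_∘_)
  open import Relation.Binary.PropositionalEquality using (_≡_; refl; sym; trans; cong; cong₂; module ≡-Reasoning)
  open ≡-Reasoning

  two^ three^ : ℕ → ℤ
  two^ k = + (2 ℕ.^ k)
  three^ k = + (3 ℕ.^ k)

  two^-suc : ∀ k → two^ (suc k) ≡ + 2 * two^ k
  two^-suc k = pos-* 2 (2 ℕ.^ k)

  three^-suc : ∀ k → three^ (suc k) ≡ + 3 * three^ k
  three^-suc k = pos-* 3 (3 ℕ.^ k)

  pos-∸ : ∀ {x y} → y ≤ x → + (x ℕ.∸ y) ≡ + x - + y
  pos-∸ {x} {y} y≤x = trans (sym (⊖-≥ y≤x)) (sym (m-n≡m⊖n x y))

  two^-+ : ∀ x y → two^ (x ℕ.+ y) ≡ two^ x * two^ y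
  two^-+ x y = trans (cong +_ (ℕP.^-distribˡ-+-* 2 x y)) (pos-* (2 ℕ.^ x) (2 ℕ.^ y))

  pos-suc : ∀ k → + suc k ≡ + 1 + + k
  pos-suc k = pos-+ 1 k

  pos-linear : ∀ a b c d → + (a ℕ.* b ℕ.+ c ℕ.* d) ≡ + a * + b + + c * + d
  pos-linear a b c d = trans (pos-+ (a ℕ.* b) (c ℕ.* d)) (cong₂ _+_ (pos-* a b) (pos-* c d))

  lift-recurrence : ∀ x b c d e f g → x ℕ.+ b ℕ.* c ≡ d ℕ.* e ℕ.+ f ℕ.* g → + x + + b * + c ≡ + d * + e + + f * + g
  lift-recurrence x b c d e f g eq =
    trans (sym (trans (pos-+ x (b ℕ.* c)) (cong (λ z → + x + z) (pos-* b c)))) (trans (cong +_ eq) (pos-linear d e f g))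

  pos-level : ∀ b p → + suc (b ℕ.+ p) ≡ + 1 + (+ b + + p)
  pos-level b p = trans (pos-suc (b ℕ.+ p)) (cong (λ z → + 1 + z) (pos-+ b p))

  isolate : ∀ {x y z : ℤ} → x + y ≡ z → x ≡ z - y
  isolate {x} {y} eq = trans (cancel x y) (cong (_- y) eq)
    where
    cancel : ∀ x y → x ≡ x + y - y
    cancel = solve-∀

  one-peak-count : ∀ t k → NoTargetUpTo t (suc k) →
    + 2 * + count t (suc k) (0 , 1) ≡ two^ k * two^ k - (+ k + + 1) * two^ k
  one-peak-count t zero    _    = refl
  one-peak-count t (suc k) none = begin
    + 2 * + count t (2 ℕ.+ k) (0 , 1)
      ≡⟨ cong (+ 2 *_) (trans (cong +_ (count-one-peak-step t k none)) (pos-linear 4 A k (2 ℕ.^ k))) ⟩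
    + 2 * (+ 4 * + A + + k * X)
      ≡⟨ regroup (+ A) (+ k) X ⟩
    + 4 * (+ 2 * + A) + + 2 * + k * X
      ≡⟨ cong (λ z → + 4 * z + + 2 * + k * X) (one-peak-count t k (none ∘ ℕP.m≤n⇒m≤1+n)) ⟩
    + 4 * (X * X - (+ k + + 1) * X) + + 2 * + k * X
      ≡⟨ close (+ k) X ⟩
    (+ 2 * X) * (+ 2 * X) - ((+ 1 + + k) + + 1) * (+ 2 * X)
      ≡⟨ cong₂ (λ x k′ → x * x - (k′ + + 1) * x) (sym (two^-suc k)) (sym (pos-suc k)) ⟩
    two^ (suc k) * two^ (suc k) - (+ suc k + + 1) * two^ (suc k)
      ∎
    where
    A : ℕ
    A = count t (suc k) (0 , 1)
    X : ℤ
    X = two^ k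
    regroup : ∀ a k x → + 2 * (+ 4 * a + k * x) ≡ + 4 * (+ 2 * a) + + 2 * k * x
    regroup = solve-∀
    close : ∀ k x → + 4 * (x * x - (k + + 1) * x) + + 2 * k * x ≡ (+ 2 * x) * (+ 2 * x) - ((+ 1 + k) + + 1) * (+ 2 * x)
    close = solve-∀

  two-peaks-count : ∀ t k → NoTargetUpTo t (suc k) →
    + 16 * + count t (suc k) (0 , 2) ≡ + 3 * two^ k * three^ k - + 4 * + k * two^ k * two^ k + (+ 2 * + k * + k - + 3) * two^ k
  two-peaks-count t zero    _    = refl
  two-peaks-count t (suc k) none = begin
    + 16 * + count t (2 ℕ.+ k) (0 , 2)
      ≡⟨ cong (+ 16 *_) (isolate (lift-recurrence (count t (2 ℕ.+ k) (0 , 2)) 2 A₁ 6 A₂ k A₁ (count-two-peaks-step t k none))) ⟩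
    + 16 * (+ 6 * + A₂ + + k * + A₁ - + 2 * + A₁)
      ≡⟨ regroup (+ A₁) (+ A₂) (+ k) ⟩
    + 6 * (+ 16 * + A₂) + + 8 * (+ k - + 2) * (+ 2 * + A₁)
      ≡⟨ cong₂ (λ a₂ a₁ → + 6 * a₂ + + 8 * (+ k - + 2) * a₁) (two-peaks-count t k none′) (one-peak-count t k none′) ⟩
    + 6 * (+ 3 * X * Y - + 4 * + k * X * X + (+ 2 * + k * + k - + 3) * X) + + 8 * (+ k - + 2) * (X * X - (+ k + + 1) * X)
      ≡⟨ close (+ k) X Y ⟩
    + 3 * (+ 2 * X) * (+ 3 * Y) - + 4 * (+ 1 + + k) * (+ 2 * X) * (+ 2 * X) + (+ 2 * (+ 1 + + k) * (+ 1 + + k) - + 3) * (+ 2 * X)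
      ≡⟨ sym (cong₃ (λ x y k′ → + 3 * x * y - + 4 * k′ * x * x + (+ 2 * k′ * k′ - + 3) * x) (two^-suc k) (three^-suc k) (pos-suc k)) ⟩
    + 3 * two^ (suc k) * three^ (suc k) - + 4 * + suc k * two^ (suc k) * two^ (suc k) + (+ 2 * + suc k * + suc k - + 3) * two^ (suc k)
      ∎
    where
    A₁ : ℕ
    A₁ = count t (suc k) (0 , 1)
    A₂ : ℕ
    A₂ = count t (suc k) (0 , 2)
    X : ℤ
    X = two^ k
    Y : ℤ
    Y = three^ k
    none′ : NoTargetUpTo t (suc k)
    none′ = none ∘ ℕP.m≤n⇒m≤1+n
    regroup : ∀ a₁ a₂ k → + 16 * (+ 6 * a₂ + k * a₁ - + 2 * a₁) ≡ + 6 * (+ 16 * a₂) + + 8 * (k - + 2) * (+ 2 * a₁)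
    regroup = solve-∀
    close : ∀ k x y → + 6 * (+ 3 * x * y - + 4 * k * x * x + (+ 2 * k * k - + 3) * x) + + 8 * (k - + 2) * (x * x - (k + + 1) * x)
                    ≡ + 3 * (+ 2 * x) * (+ 3 * y) - + 4 * (+ 1 + k) * (+ 2 * x) * (+ 2 * x) + (+ 2 * (+ 1 + k) * (+ 1 + k) - + 3) * (+ 2 * x)
    close = solve-∀

  -- #{σ ∈ 𝔖ᵢ : CP(σ) = {i}}, i = p + 2
  solo : ℕ → ℤ
  solo p = two^ p * two^ p - two^ p

  -- 4 · #{σ ∈ 𝔖ᵢ : CP(σ) = {i, x} for some x} + 2p · solo p, i = p + 2
  duo : ℕ → ℤ
  duo p = + 3 * two^ p * three^ p - + 4 * two^ p * two^ p + two^ p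

  above-first-target : ∀ t p b → OneTargetUpTo t (2 ℕ.+ p) (3 ℕ.+ (b ℕ.+ p)) → t (3 ℕ.+ (b ℕ.+ p)) ≡ false
  above-first-target t p b one = one-target-elsewhere one ℕP.≤-refl (ℕP.>⇒≢ (s≤s (s≤s (s≤s (ℕP.m≤n+m p b)))))

  first-target-count : ∀ t p b → t (2 ℕ.+ p) ≡ true → OneTargetUpTo t (2 ℕ.+ p) (2 ℕ.+ (b ℕ.+ p)) →
    + count t (2 ℕ.+ (b ℕ.+ p)) (1 , 0) ≡ two^ b * solo p
  first-target-count t p zero t[i] one = begin
    + count t (2 ℕ.+ p) (1 , 0)
      ≡⟨ cong +_ (count-first-target-step t p t[i] none) ⟩
    + (p ℕ.* 2 ℕ.^ p ℕ.+ 2 ℕ.* A₁)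
      ≡⟨ pos-linear p (2 ℕ.^ p) 2 A₁ ⟩
    + p * U + + 2 * + A₁
      ≡⟨ cong (λ a → + p * U + a) (one-peak-count t p none) ⟩
    + p * U + (U * U - (+ p + + 1) * U)
      ≡⟨ close (+ p) U ⟩
    + 1 * (U * U - U)
      ∎
    where
    U : ℤ
    U = two^ p
    A₁ : ℕ
    A₁ = count t (suc p) (0 , 1)
    none : NoTargetUpTo t (suc p)
    none = one-target-below one (ℕP.n≤1+n (suc p))
    close : ∀ p u → p * u + (u * u - (p + + 1) * u) ≡ + 1 * (u * u - u)
    close = solve-∀
  first-target-count t p (suc b) t[i] one = begin
    + count t (3 ℕ.+ (b ℕ.+ p)) (1 , 0)
      ≡⟨ trans (cong +_ (count-fresh-zero t (suc (b ℕ.+ p)) (above-first-target t p b one) 1)) (pos-* 2 G) ⟩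
    + 2 * + G
      ≡⟨ cong (+ 2 *_) (first-target-count t p b t[i] (one-target-restrict one (ℕP.n≤1+n _))) ⟩
    + 2 * (two^ b * solo p)
      ≡⟨ trans (cong (_* solo p) (two^-suc b)) (*-assoc (+ 2) (two^ b) (solo p)) ⟨
    two^ (suc b) * solo p
      ∎
    where
    G : ℕ
    G = count t (2 ℕ.+ (b ℕ.+ p)) (1 , 0)

  first-target-pair-count : ∀ t p b → t (2 ℕ.+ p) ≡ true → OneTargetUpTo t (2 ℕ.+ p) (2 ℕ.+ (b ℕ.+ p)) →
    + 4 * + count t (2 ℕ.+ (b ℕ.+ p)) (1 , 1) ≡ two^ b * two^ b * duo p - + 2 * two^ b * (+ b + + p) * solo p
  first-target-pair-count t p zero t[i] one = begin
    + 4 * + count t (2 ℕ.+ p) (1 , 1)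
      ≡⟨ cong (+ 4 *_) (isolate (lift-recurrence (count t (2 ℕ.+ p) (1 , 1)) 2 A₁ p A₁ 4 A₂
           (count-first-target-pair-step t p t[i] none))) ⟩
    + 4 * (+ p * + A₁ + + 4 * + A₂ - + 2 * + A₁)
      ≡⟨ regroup (+ A₁) (+ A₂) (+ p) ⟩
    + 2 * (+ p - + 2) * (+ 2 * + A₁) + + 16 * + A₂
      ≡⟨ cong₂ (λ a₁ a₂ → + 2 * (+ p - + 2) * a₁ + a₂) (one-peak-count t p none) (two-peaks-count t p none) ⟩
    + 2 * (+ p - + 2) * (U * U - (+ p + + 1) * U) + (+ 3 * U * V - + 4 * + p * U * U + (+ 2 * + p * + p - + 3) * U)
      ≡⟨ close (+ p) U V ⟩
    + 1 * + 1 * duo p - + 2 * + 1 * (+ 0 + + p) * solo p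
      ∎
    where
    U : ℤ
    U = two^ p
    V : ℤ
    V = three^ p
    A₁ : ℕ
    A₁ = count t (suc p) (0 , 1)
    A₂ : ℕ
    A₂ = count t (suc p) (0 , 2)
    none : NoTargetUpTo t (suc p)
    none = one-target-below one (ℕP.n≤1+n (suc p))
    regroup : ∀ a₁ a₂ p → + 4 * (p * a₁ + + 4 * a₂ - + 2 * a₁) ≡ + 2 * (p - + 2) * (+ 2 * a₁) + + 16 * a₂
    regroup = solve-∀
    close : ∀ p u v → + 2 * (p - + 2) * (u * u - (p + + 1) * u) + (+ 3 * u * v - + 4 * p * u * u + (+ 2 * p * p - + 3) * u)
                    ≡ + 1 * + 1 * (+ 3 * u * v - + 4 * u * u + u) - + 2 * + 1 * (+ 0 + p) * (u * u - u)
    close = solve-∀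
  first-target-pair-count t p (suc b) t[i] one = begin
    + 4 * + count t (3 ℕ.+ (b ℕ.+ p)) (1 , 1)
      ≡⟨ cong (+ 4 *_) (isolate (lift-recurrence (count t (3 ℕ.+ (b ℕ.+ p)) (1 , 1)) 2 G 4 D (suc (b ℕ.+ p)) G
           (count-target-pair-fresh-step t (suc (b ℕ.+ p)) (2 ℕ.+ p) (above-first-target t p b one) one′))) ⟩
    + 4 * (+ 4 * + D + + suc (b ℕ.+ p) * + G - + 2 * + G)
      ≡⟨ cong (λ k → + 4 * (+ 4 * + D + k * + G - + 2 * + G)) (pos-level b p) ⟩
    + 4 * (+ 4 * + D + (+ 1 + (+ b + + p)) * + G - + 2 * + G)
      ≡⟨ regroup (+ D) (+ G) (+ b) (+ p) ⟩
    + 4 * (+ 4 * + D) + + 4 * (+ b + + p - + 1) * + G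
      ≡⟨ cong₂ (λ d g → + 4 * d + + 4 * (+ b + + p - + 1) * g)
               (first-target-pair-count t p b t[i] one′) (first-target-count t p b t[i] one′) ⟩
    + 4 * (W * W * duo p - + 2 * W * (+ b + + p) * solo p) + + 4 * (+ b + + p - + 1) * (W * solo p)
      ≡⟨ close W (+ b) (+ p) (duo p) (solo p) ⟩
    (+ 2 * W) * (+ 2 * W) * duo p - + 2 * (+ 2 * W) * ((+ 1 + + b) + + p) * solo p
      ≡⟨ cong₂ (λ w b′ → w * w * duo p - + 2 * w * (b′ + + p) * solo p) (sym (two^-suc b)) (sym (pos-suc b)) ⟩
    two^ (suc b) * two^ (suc b) * duo p - + 2 * two^ (suc b) * (+ suc b + + p) * solo p
      ∎
    where
    W : ℤ
    W = two^ b
    G : ℕ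
    G = count t (2 ℕ.+ (b ℕ.+ p)) (1 , 0)
    D : ℕ
    D = count t (2 ℕ.+ (b ℕ.+ p)) (1 , 1)
    one′ : OneTargetUpTo t (2 ℕ.+ p) (2 ℕ.+ (b ℕ.+ p))
    one′ = one-target-restrict one (ℕP.n≤1+n _)
    regroup : ∀ d g b p → + 4 * (+ 4 * d + (+ 1 + (b + p)) * g - + 2 * g) ≡ + 4 * (+ 4 * d) + + 4 * (b + p - + 1) * g
    regroup = solve-∀
    close : ∀ w b p q s → + 4 * (w * w * q - + 2 * w * (b + p) * s) + + 4 * (b + p - + 1) * (w * s)
                        ≡ (+ 2 * w) * (+ 2 * w) * q - + 2 * (+ 2 * w) * ((+ 1 + b) + p) * s
    close = solve-∀

  second-target-count : ∀ t p q → t (2 ℕ.+ p) ≡ true → t (3 ℕ.+ (q ℕ.+ p)) ≡ true →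
    OneTargetUpTo t (2 ℕ.+ p) (2 ℕ.+ (q ℕ.+ p)) →
    + 2 * + count t (3 ℕ.+ (q ℕ.+ p)) (2 , 0) ≡ two^ q * two^ q * duo p - + 2 * two^ q * solo p
  second-target-count t p q t[i] t[j] one = begin
    + 2 * + count t (3 ℕ.+ (q ℕ.+ p)) (2 , 0)
      ≡⟨ cong (+ 2 *_) (isolate (lift-recurrence (count t (3 ℕ.+ (q ℕ.+ p)) (2 , 0)) 2 G (suc (q ℕ.+ p)) G 2 D
           (count-second-target-step t (suc (q ℕ.+ p)) (2 ℕ.+ p) t[j] one))) ⟩
    + 2 * (+ suc (q ℕ.+ p) * + G + + 2 * + D - + 2 * + G)
      ≡⟨ cong (λ k → + 2 * (k * + G + + 2 * + D - + 2 * + G)) (pos-level q p) ⟩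
    + 2 * ((+ 1 + (+ q + + p)) * + G + + 2 * + D - + 2 * + G)
      ≡⟨ regroup (+ D) (+ G) (+ q) (+ p) ⟩
    + 2 * (+ q + + p - + 1) * + G + + 4 * + D
      ≡⟨ cong₂ (λ g d → + 2 * (+ q + + p - + 1) * g + d) (first-target-count t p q t[i] one) (first-target-pair-count t p q t[i] one) ⟩
    + 2 * (+ q + + p - + 1) * (W * solo p) + (W * W * duo p - + 2 * W * (+ q + + p) * solo p)
      ≡⟨ close W (+ q) (+ p) (duo p) (solo p) ⟩
    W * W * duo p - + 2 * W * solo p
      ∎
    where
    W : ℤ
    W = two^ q
    G : ℕ
    G = count t (2 ℕ.+ (q ℕ.+ p)) (1 , 0)
    D : ℕ
    D = count t (2 ℕ.+ (q ℕ.+ p)) (1 , 1)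
    regroup : ∀ d g q p → + 2 * ((+ 1 + (q + p)) * g + + 2 * d - + 2 * g) ≡ + 2 * (q + p - + 1) * g + + 4 * d
    regroup = solve-∀
    close : ∀ w q p r s → + 2 * (q + p - + 1) * (w * s) + (w * w * r - + 2 * w * (q + p) * s) ≡ w * w * r - + 2 * w * s
    close = solve-∀

  second-target-count-later : ∀ t p q c → t (2 ℕ.+ p) ≡ true → t (3 ℕ.+ (q ℕ.+ p)) ≡ true →
    OneTargetUpTo t (2 ℕ.+ p) (2 ℕ.+ (q ℕ.+ p)) → (∀ {x} → 3 ℕ.+ (q ℕ.+ p) ℕ.< x → t x ≡ false) →
    + 2 * + count t (3 ℕ.+ (c ℕ.+ (q ℕ.+ p))) (2 , 0) ≡ two^ c * (two^ q * two^ q * duo p - + 2 * two^ q * solo p)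
  second-target-count-later t p q zero    t[i] t[j] one above = trans (second-target-count t p q t[i] t[j] one) (sym (*-identityˡ _))
  second-target-count-later t p q (suc c) t[i] t[j] one above = begin
    + 2 * + count t (4 ℕ.+ (c ℕ.+ (q ℕ.+ p))) (2 , 0)
      ≡⟨ cong (+ 2 *_) (trans (cong +_ (count-fresh-zero t (2 ℕ.+ (c ℕ.+ (q ℕ.+ p))) fresh 2))
                              (pos-* 2 (count t (3 ℕ.+ (c ℕ.+ (q ℕ.+ p))) (2 , 0)))) ⟩
    + 2 * (+ 2 * + count t (3 ℕ.+ (c ℕ.+ (q ℕ.+ p))) (2 , 0))
      ≡⟨ cong (+ 2 *_) (second-target-count-later t p q c t[i] t[j] one above) ⟩
    + 2 * (two^ c * H)
      ≡⟨ trans (cong (_* H) (two^-suc c)) (*-assoc (+ 2) (two^ c) H) ⟨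
    two^ (suc c) * H
      ∎
    where
    H : ℤ
    H = two^ q * two^ q * duo p - + 2 * two^ q * solo p
    fresh : t (4 ℕ.+ (c ℕ.+ (q ℕ.+ p))) ≡ false
    fresh = above (s≤s (s≤s (s≤s (s≤s (ℕP.m≤n+m _ c)))))

  count-single-peak-set : ∀ {i n} → 3 ≤ i → i ≤ n →
    count (_∈ᵇ (i ∷ [])) n (1 , 0) ≡ 2 ℕ.^ (n ℕ.∸ 2) ℕ.* (2 ℕ.^ (i ℕ.∸ 2) ℕ.∸ 1)
  count-single-peak-set {suc (suc (suc a))} {n} (s≤s (s≤s (s≤s _))) i≤n
    with n ℕ.∸ (3 ℕ.+ a) | level-shift 2 (suc a) i≤n
  ... | b | refl = +-injective (begin
    + count t (2 ℕ.+ (b ℕ.+ p)) (1 , 0)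
      ≡⟨ first-target-count t p b (∈ᵇ-head (2 ℕ.+ p) []) (one-target-singleton (2 ℕ.+ p) _) ⟩
    two^ b * (U * U - U)
      ≡⟨ regroup (two^ b) U ⟩
    two^ b * U * (U - + 1)
      ≡⟨ cong₂ _*_ (two^-+ b p) (pos-∸ (ℕP.m^n>0 2 p)) ⟨
    + (2 ℕ.^ (b ℕ.+ p)) * + (2 ℕ.^ p ℕ.∸ 1)
      ≡⟨ pos-* (2 ℕ.^ (b ℕ.+ p)) (2 ℕ.^ p ℕ.∸ 1) ⟨
    + (2 ℕ.^ (b ℕ.+ p) ℕ.* (2 ℕ.^ p ℕ.∸ 1))
      ∎)
    where
    p : ℕ
    p = suc a
    t : ℕ → Bool
    t = _∈ᵇ (2 ℕ.+ p ∷ [])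
    U : ℤ
    U = two^ p
    regroup : ∀ w u → w * (u * u - u) ≡ w * u * (u - + 1)
    regroup = solve-∀

  pair-count-formula : ℕ → ℕ → ℕ → ℕ
  pair-count-formula n i j =
    2 ℕ.^ (n ℕ.∸ 3) ℕ.* (2 ℕ.^ (i ℕ.∸ 2) ℕ.∸ 1) ℕ.* (2 ℕ.^ (j ℕ.∸ i ℕ.∸ 1) ℕ.∸ 1)
    ℕ.+ 2 ℕ.^ (n ℕ.+ j ℕ.∸ i ℕ.∸ 5) ℕ.* 3 ℕ.* ((3 ℕ.^ (i ℕ.∸ 2) ℕ.+ 1) ℕ.∸ 2 ℕ.^ (i ℕ.∸ 1))

  pair-count-formula-ℤ : ∀ a q c →
    + 2 * + pair-count-formula (3 ℕ.+ (c ℕ.+ (q ℕ.+ suc a))) (3 ℕ.+ a) (3 ℕ.+ (q ℕ.+ suc a))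
      ≡ two^ c * (two^ q * two^ q * duo (suc a) - + 2 * two^ q * solo (suc a))
  pair-count-formula-ℤ a q c = begin
    + 2 * + (X ℕ.* B ℕ.* G ℕ.+ D ℕ.* 3 ℕ.* E)
      ≡⟨ cong (+ 2 *_) lifted ⟩
    + 2 * (C * (W * (+ 2 * A)) * (+ 2 * A - + 1) * (W - + 1) + C * (W * (W * A)) * + 3 * ((V + + 1) - + 2 * (+ 2 * A)))
      ≡⟨ key A W C V ⟨
    C * (W * W * (+ 3 * (+ 2 * A) * V - + 4 * (+ 2 * A) * (+ 2 * A) + + 2 * A) - + 2 * W * ((+ 2 * A) * (+ 2 * A) - + 2 * A))
      ≡⟨ cong (λ u → C * (W * W * (+ 3 * u * V - + 4 * u * u + u) - + 2 * W * (u * u - u))) (two^-suc a) ⟨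
    C * (W * W * duo p - + 2 * W * solo p)
      ∎
    where
    p : ℕ
    p = suc a
    A W C V : ℤ
    A = two^ a
    W = two^ q
    C = two^ c
    V = three^ p
    X B G D E : ℕ
    X = 2 ℕ.^ (c ℕ.+ (q ℕ.+ p))
    B = 2 ℕ.^ p ℕ.∸ 1
    G = 2 ℕ.^ (3 ℕ.+ (q ℕ.+ p) ℕ.∸ (2 ℕ.+ p) ℕ.∸ 1) ℕ.∸ 1
    D = 2 ℕ.^ (3 ℕ.+ (c ℕ.+ (q ℕ.+ p)) ℕ.+ (3 ℕ.+ (q ℕ.+ p)) ℕ.∸ (2 ℕ.+ p) ℕ.∸ 5)
    E = (3 ℕ.^ p ℕ.+ 1) ℕ.∸ 2 ℕ.^ suc p
    lifted : + (X ℕ.* B ℕ.* G ℕ.+ D ℕ.* 3 ℕ.* E)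
           ≡ C * (W * (+ 2 * A)) * (+ 2 * A - + 1) * (W - + 1) + C * (W * (W * A)) * + 3 * ((V + + 1) - + 2 * (+ 2 * A))
    lifted = trans (pos-+ (X ℕ.* B ℕ.* G) (D ℕ.* 3 ℕ.* E))
      (cong₂ _+_ (trans (pos-* (X ℕ.* B) G) (cong₂ _*_ (trans (pos-* X B) (cong₂ _*_ X≡ B≡)) G≡))
                 (trans (pos-* (D ℕ.* 3) E) (cong₂ _*_ (trans (pos-* D 3) (cong (_* + 3) D≡)) E≡)))
      where
      U≡ : two^ p ≡ + 2 * A
      U≡ = two^-suc a
      X≡ : + X ≡ C * (W * (+ 2 * A))
      X≡ = trans (two^-+ c (q ℕ.+ p)) (cong (C *_) (trans (two^-+ q p) (cong (W *_) U≡)))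
      B≡ : + B ≡ + 2 * A - + 1
      B≡ = trans (pos-∸ (ℕP.m^n>0 2 p)) (cong (_- + 1) U≡)
      G≡ : + G ≡ W - + 1
      G≡ = trans (cong (λ e → + (2 ℕ.^ e ℕ.∸ 1)) (exponent-gap q a)) (pos-∸ (ℕP.m^n>0 2 q))
      D≡ : + D ≡ C * (W * (W * A))
      D≡ = trans (cong two^ (exponent-span c q a))
             (trans (two^-+ c (q ℕ.+ (q ℕ.+ a))) (cong (C *_) (trans (two^-+ q (q ℕ.+ a)) (cong (W *_) (two^-+ q a)))))
      E≡ : + E ≡ (V + + 1) - + 2 * (+ 2 * A)
      E≡ = trans (pos-∸ (2^≤3^+1 a)) (cong₂ _-_ (pos-+ (3 ℕ.^ p) 1) (trans (two^-suc p) (cong (+ 2 *_) U≡)))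
    key : ∀ A W C V →
      C * (W * W * (+ 3 * (+ 2 * A) * V - + 4 * (+ 2 * A) * (+ 2 * A) + + 2 * A) - + 2 * W * ((+ 2 * A) * (+ 2 * A) - + 2 * A))
        ≡ + 2 * (C * (W * (+ 2 * A)) * (+ 2 * A - + 1) * (W - + 1) + C * (W * (W * A)) * + 3 * ((V + + 1) - + 2 * (+ 2 * A)))
    key = solve-∀

  count-pair-peak-set : ∀ {i j n} → 3 ≤ i → i < j → j ≤ n → count (_∈ᵇ (i ∷ j ∷ [])) n (2 , 0) ≡ pair-count-formula n i j
  count-pair-peak-set {suc (suc (suc a))} {j} {n} (s≤s (s≤s (s≤s _))) i<j j≤n
    with j ℕ.∸ (3 ℕ.+ suc a) | level-shift 3 (suc a) i<j
  ... | q | refl with n ℕ.∸ (3 ℕ.+ (q ℕ.+ suc a)) | level-shift 3 (q ℕ.+ suc a) j≤n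
  ... | c | refl = +-injective (*-cancelˡ-≡ (+ 2) _ _ (trans
    (second-target-count-later t p q c (∈ᵇ-head (2 ℕ.+ p) (3 ℕ.+ (q ℕ.+ p) ∷ [])) (∈ᵇ-second (2 ℕ.+ p) (3 ℕ.+ (q ℕ.+ p)))
      (one-target-pair ℕP.≤-refl)
      (above-pair (s≤s (s≤s (s≤s (ℕP.m≤n+m p q))))))
    (sym (pair-count-formula-ℤ a q c))))
    where
    p : ℕ
    p = suc a
    t : ℕ → Bool
    t = _∈ᵇ (2 ℕ.+ p ∷ 3 ℕ.+ (q ℕ.+ p) ∷ [])

open import Data.Nat using (ℕ; suc; _≤_; _<_; _+_; _*_; _∸_; _^_)
open import Data.Nat.Properties using (<⇒≢)
open import Data.List using ([]; _∷_)
open import Data.List.Relation.Unary.All using ([]; _∷_)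
open import Data.List.Relation.Unary.Unique.Propositional using ([]; _∷_)
open import Data.Product using (_×_; _,_)
open import Relation.Binary.PropositionalEquality using (subst)
open PeakTallies using (_∈ᵇ_; count-empty; cp-peak-set)
open ClosedForms using (count-single-peak-set; count-pair-peak-set)

theorem2p1 : ∀ n → 3 ≤ n →
    cp n [] (2 ^ (n ∸ 1))
    × (∀ i → 3 ≤ i → i ≤ n →
        cp n (i ∷ []) (2 ^ (n ∸ 2) * (2 ^ (i ∸ 2) ∸ 1)))
    × (∀ i j → 3 ≤ i → i < j → j ≤ n →
        cp n (i ∷ j ∷ [])
          (2 ^ (n ∸ 3) * (2 ^ (i ∸ 2) ∸ 1) * (2 ^ (j ∸ i ∸ 1) ∸ 1)
           + 2 ^ (n + j ∸ i ∸ 5) * 3 * ((3 ^ (i ∸ 2) + 1) ∸ 2 ^ (i ∸ 1))))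
theorem2p1 n@(suc k) _ =
    subst (cp n []) (count-empty (_∈ᵇ []) k) (cp-peak-set n [] [])
  , (λ i 3≤i i≤n → subst (cp n (i ∷ [])) (count-single-peak-set 3≤i i≤n) (cp-peak-set n (i ∷ []) ([] ∷ [])))
  , (λ i j 3≤i i<j j≤n → subst (cp n (i ∷ j ∷ [])) (count-pair-peak-set 3≤i i<j j≤n)
                           (cp-peak-set n (i ∷ j ∷ []) ((<⇒≢ i<j ∷ []) ∷ [] ∷ [])))
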